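{- Let $n\ge 1$, let $\mu=(\mu_1,\ldots,\mu_n)$ be a partition with distinct parts, i.e. integers $\mu_1>\mu_2>\cdots>\mu_n\ge 0$, and fix integers $n\ge c_\ell\ge c_{\ell-1}\ge\cdots\ge c_1\ge 1$. Let $\mathbf{T}=(T_\ell,\ldots,T_1)$ be a list of nonnegative integers. Then $$\sum_{\sigma\in S_n}\mathrm{sgn}(\sigma)\,h_{T_\ell}(x_{\sigma_1},\ldots,x_{\sigma_{c_\ell}})\cdots h_{T_1}(x_{\sigma_1},\ldots,x_{\sigma_{c_1}})\,x_{\sigma_1}^{\mu_1}\cdots x_{\sigma_n}^{\mu_n}=\sum_{\Lambda}\ \sum_{\sigma\in S_n}\mathrm{sgn}(\sigma)\,x_{\sigma_1}^{\lambda_1}\cdots x_{\sigma_n}^{\lambda_n},$$ where the outer sum on the right runs over all good $\mathbf{T}$-extensions $\Lambda=(\lambda=\lambda^\ell\supseteq\cdots\supseteq\lambda^1\supseteq\lambda^0=\mu)$ of $\mu$, and $\lambda=\lambda^\ell$ denotes the largest composition of $\Lambda$.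
   Context: $h_T$ denotes the complete homogeneous symmetric polynomial of degree $T$ (with $h_0=1$), and $\sigma_i=\sigma(i)$. For compositions (vectors of nonnegative integers) of length $n$, $\alpha\supseteq\beta$ means $\alpha_k\ge\beta_k$ for all $k$, and $|\alpha|=\sum_k\alpha_k$. A $\mathbf{T}$-extension of $\mu$ is a sequence of length-$n$ compositions $\lambda^\ell\supseteq\cdots\supseteq\lambda^1\supseteq\lambda^0=\mu$ such that for every $1\le h\le\ell$: $|\lambda^h|-|\lambda^{h-1}|=T_h$, and $\lambda^h_k=\lambda^{h-1}_k$ for all $k>c_h$. A $\mathbf{T}$-extension is good if $\lambda^h_k<\lambda^{h-1}_{k-1}$ for all $2\le k\le c_h$ and all $1\le h\le\ell$. -}

module Defs where

open import Level using (Level)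
open import Data.Nat using (ℕ; zero; suc; _+_; _≤_; _<_; _≤?_; _<?_)
open import Data.Nat.Properties using () renaming (_≟_ to _≟ℕ_)
open import Data.Fin using (Fin; toℕ; inject₁; inject≤) renaming (zero to fzero; suc to fsuc)
open import Data.Fin.Properties using (all?) renaming (_≟_ to _≟F_)
open import Data.Vec using (Vec; []; _∷_; lookup; sum)
open import Data.Vec.Properties using (≡-dec)
open import Data.List using (List; []; _∷_; [_]; map; concatMap; filter; upTo; allFin)
open import Data.Product using (_×_; _,_)
open import Relation.Binary.PropositionalEquality using (_≡_)
open import Relation.Nullary using (Dec; yes; no)
open import Relation.Nullary.Decidable using (_×-dec_; _→-dec_)
open import Algebra.Bundles using (CommutativeRing)

allVecs : ∀ {a} {A : Set a} → List A → (n : ℕ) → List (Vec A n)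
allVecs xs zero    = [ [] ]
allVecs xs (suc n) = concatMap (λ a → map (a ∷_) (allVecs xs n)) xs

compsUpTo : (n B : ℕ) → List (Vec ℕ n)
compsUpTo n B = allVecs (upTo (suc B)) n

-- Permutations of Fin n (σ i = lookup σ i), i.e. the elements of S_n

IsPerm : ∀ {n} → Vec (Fin n) n → Set
IsPerm {n} σ = ∀ (i j : Fin n) → lookup σ i ≡ lookup σ j → i ≡ j

isPerm? : ∀ {n} (σ : Vec (Fin n) n) → Dec (IsPerm σ)
isPerm? σ = all? λ i → all? λ j → (lookup σ i ≟F lookup σ j) →-dec (i ≟F j)

Sn : (n : ℕ) → List (Vec (Fin n) n)
Sn n = filter isPerm? (allVecs (allFin n) n)

countFin : ∀ {n} → (Fin n → ℕ) → ℕ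
countFin {zero}  f = 0
countFin {suc n} f = f fzero + countFin (λ i → f (fsuc i))

indicator : ∀ {p} {P : Set p} → Dec P → ℕ
indicator (yes _) = 1
indicator (no _) = 0

inversions : ∀ {n} → Vec (Fin n) n → ℕ
inversions {n} σ = countFin λ (i : Fin n) → countFin λ (j : Fin n) →
  indicator ((toℕ i <? toℕ j) ×-dec (toℕ (lookup σ j) <? toℕ (lookup σ i)))

-- T-extensions.  ℓ steps; index h : Fin ℓ stands for step h+1 of the paper.
-- Λ : Vec (Vec ℕ n) (suc ℓ), lookup Λ i = λ^i (0-based positions k : Fin n).

module _ {n ℓ : ℕ} (c T : Fin ℓ → ℕ) (μ : Vec ℕ n) where

  StepOK : Vec (Vec ℕ n) (suc ℓ) → Fin ℓ → Set
  StepOK Λ h =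
    (∀ k → lookup prev k ≤ lookup cur k)
    × (sum cur ≡ sum prev + T h)
    × (∀ k → c h ≤ toℕ k → lookup cur k ≡ lookup prev k)
    where prev = lookup Λ (inject₁ h)
          cur  = lookup Λ (fsuc h)

  IsTExtension : Vec (Vec ℕ n) (suc ℓ) → Set
  IsTExtension Λ = (lookup Λ fzero ≡ μ) × (∀ h → StepOK Λ h)

  -- goodness: λ^h_k < λ^{h-1}_{k-1} for 2 ≤ k ≤ c_h (1-based k)
  GoodStep : Vec (Vec ℕ n) (suc ℓ) → Fin ℓ → Set
  GoodStep Λ h = ∀ (j k : Fin n) → toℕ k ≡ suc (toℕ j) → toℕ k < c h →
                   lookup (lookup Λ (fsuc h)) k < lookup (lookup Λ (inject₁ h)) j

  IsGoodTExtension : Vec (Vec ℕ n) (suc ℓ) → Set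
  IsGoodTExtension Λ = IsTExtension Λ × (∀ h → GoodStep Λ h)

  isGoodTExtension? : ∀ Λ → Dec (IsGoodTExtension Λ)
  isGoodTExtension? Λ =
    ((≡-dec _≟ℕ_ (lookup Λ fzero) μ)
      ×-dec all? (λ h →
        all? (λ k → lookup (lookup Λ (inject₁ h)) k ≤? lookup (lookup Λ (fsuc h)) k)
        ×-dec (sum (lookup Λ (fsuc h)) ≟ℕ sum (lookup Λ (inject₁ h)) + T h)
        ×-dec all? (λ k → (c h ≤? toℕ k) →-dec
                 (lookup (lookup Λ (fsuc h)) k ≟ℕ lookup (lookup Λ (inject₁ h)) k))))
    ×-dec all? (λ h → all? λ j → all? λ k → (toℕ k ≟ℕ suc (toℕ j)) →-dec ((toℕ k <? c h) →-dec
             (lookup (lookup Λ (fsuc h)) k <? lookup (lookup Λ (inject₁ h)) j)))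

  sumFin : ∀ {m} → (Fin m → ℕ) → ℕ
  sumFin {zero} f = 0
  sumFin {suc m} f = f fzero + sumFin (λ i → f (fsuc i))

  -- every entry of every member of a T-extension is ≤ |μ| + Σ T_h, so this
  -- finite list contains all T-extensions (each exactly once)
  candidates : List (Vec (Vec ℕ n) (suc ℓ))
  candidates = allVecs (compsUpTo n (sum μ + sumFin T)) (suc ℓ)

  goodTExtensions : List (Vec (Vec ℕ n) (suc ℓ))
  goodTExtensions = filter isGoodTExtension? candidates

module RingDefs {a r : Level} (R : CommutativeRing a r) where
  open CommutativeRing R using (Carrier; 0#; 1#; -_) renaming (_+_ to _+ᴿ_; _*_ to _*ᴿ_)

  sumL : List Carrier → Carrier
  sumL []       = 0#
  sumL (x ∷ xs) = x +ᴿ sumL xs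

  prodFin : ∀ {m} → (Fin m → Carrier) → Carrier
  prodFin {zero}  f = 1#
  prodFin {suc m} f = f fzero *ᴿ prodFin (λ i → f (fsuc i))

  pow : Carrier → ℕ → Carrier
  pow x zero    = 1#
  pow x (suc k) = x *ᴿ pow x k

  negOnePow : ℕ → Carrier
  negOnePow zero    = 1#
  negOnePow (suc k) = - negOnePow k

  sgn : ∀ {m} → Vec (Fin m) m → Carrier
  sgn σ = negOnePow (inversions σ)

  h : (m T : ℕ) → (Fin m → Carrier) → Carrier
  h m T y = sumL (map (λ e → prodFin λ i → pow (y i) (lookup e i))
                      (filter (λ e → sum e ≟ℕ T) (compsUpTo m T)))

  monoσ : ∀ {n} → (Fin n → Carrier) → Vec (Fin n) n → Vec ℕ n → Carrier
  monoσ x σ λ' = prodFin λ i → pow (x (lookup σ i)) (lookup λ' i)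

  antisym : ∀ {n} → (Fin n → Carrier) → Vec ℕ n → Carrier
  antisym {n} x λ' = sumL (map (λ σ → sgn σ *ᴿ monoσ x σ λ') (Sn n))

module Submission where

-- The proof is by induction on ℓ and peels off the factor with the smallest
-- c = c₁.  Writing W(σ) for the product of the other factors (symmetric in
-- σ₁,…,σ_c since their c's are larger), expanding h_{T₁} into monomials
-- turns Σ_σ sgn(σ) h_{T₁} W x_σ^μ into Σ_α a_W(α) over all one-step
-- extensions α of μ, where a_W(α) = Σ_σ sgn(σ) W(σ) x_σ^α.  The steps that
-- are not good cancel: if goodness first fails at position d (α_{d+1} ≥ μ_d),
-- swapping α_d and α_{d+1} keeps α in this set and changes the sign of a_W,
-- and a_W vanishes when α_d = α_{d+1}.  Each surviving a_W(α) is expanded by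
-- the induction hypothesis (α is again strict), and regrouping by the first
-- step gives the sum over good T-extensions.

open import Defs
open import Level using (Level)
open import Data.Nat using (ℕ; zero; suc; _+_; _≤_; _<_; z≤n; s≤s; s≤s⁻¹; _≤?_; _<?_)
import Data.Nat.Properties as ℕP
open ℕP using (+-cancelʳ-≤; +-mono-≤; +-monoʳ-≤; +-suc; 1+n≢n; <-asym; <-cmp; <-irrefl; <-trans; <-≤-trans;
  <⇒≤; <⇒≯; <⇒≱; _≟_; m≤m+n; m≤n+m; m≤n⇒m<n∨m≡n; n<1+n; n≤1+n; ≤-antisym; ≤-refl; ≤-reflexive; ≤-trans;
  ≤∧≢⇒<; ≮⇒≥)
open import Data.Nat.Tactic.RingSolver using (solve-∀)
open import Algebra.Properties.CommutativeSemigroup ℕP.+-commutativeSemigroup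
  using () renaming (x∙yz≈y∙xz to +-left-comm; interchange to +-interchange)
open import Data.Fin using (Fin; toℕ; inject≤; fromℕ; fromℕ<) renaming (zero to fzero; suc to fsuc)
import Data.Fin.Properties as FinP
open import Data.Vec using (Vec; []; _∷_; lookup; sum; replicate; zipWith)
import Data.Vec as Vec
import Data.Vec.Properties as VecP
open import Data.List using (List; []; _∷_; _++_; map; concatMap; filter; upTo; applyUpTo; allFin)
import Data.List.Properties as ListP
open import Data.Bool using (true; false; if_then_else_)
open import Data.Product using (_×_; _,_; proj₁; proj₂)
open import Data.Sum using (_⊎_; inj₁; inj₂)
open import Data.Empty using (⊥-elim)
open import Data.Unit using (⊤; tt)
open import Function using (_∘_)
open import Relation.Nullary using (Dec; yes; no; ¬_; ¬?; does)
open import Relation.Nullary.Decidable using (_×-dec_; _→-dec_)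
open import Relation.Binary.Definitions using (tri<; tri≈; tri>)
open import Relation.Binary.PropositionalEquality as ≡
  using (_≡_; _≢_; refl; cong; cong₂; sym; trans; subst; subst₂; module ≡-Reasoning)
open import Algebra.Bundles using (CommutativeRing)

swapAt : ∀ {A : Set} {n} → ℕ → Vec A n → Vec A n
swapAt zero    []          = []
swapAt zero    (a ∷ [])    = a ∷ []
swapAt zero    (a ∷ b ∷ v) = b ∷ a ∷ v
swapAt (suc j) []          = []
swapAt (suc j) (a ∷ v)     = a ∷ swapAt j v

transpose : ∀ {n} → ℕ → Fin n → Fin n
transpose {suc zero}    zero    fzero            = fzero
transpose {suc (suc n)} zero    fzero            = fsuc fzero
transpose {suc (suc n)} zero    (fsuc fzero)     = fzero
transpose {suc (suc n)} zero    (fsuc (fsuc i))  = fsuc (fsuc i)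
transpose               (suc j) fzero            = fzero
transpose               (suc j) (fsuc i)         = fsuc (transpose j i)

lookup-swapAt : ∀ {A : Set} {n} j (v : Vec A n) i → lookup (swapAt j v) i ≡ lookup v (transpose j i)
lookup-swapAt zero    (a ∷ [])    fzero            = refl
lookup-swapAt zero    (a ∷ b ∷ v) fzero            = refl
lookup-swapAt zero    (a ∷ b ∷ v) (fsuc fzero)     = refl
lookup-swapAt zero    (a ∷ b ∷ v) (fsuc (fsuc i))  = refl
lookup-swapAt (suc j) (a ∷ v)     fzero            = refl
lookup-swapAt (suc j) (a ∷ v)     (fsuc i)         = lookup-swapAt j v i

swapAt-involutive : ∀ {A : Set} {n} j (v : Vec A n) → swapAt j (swapAt j v) ≡ v
swapAt-involutive zero    []          = refl
swapAt-involutive zero    (a ∷ [])    = refl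
swapAt-involutive zero    (a ∷ b ∷ v) = refl
swapAt-involutive (suc j) []          = refl
swapAt-involutive (suc j) (a ∷ v)     = cong (a ∷_) (swapAt-involutive j v)

transpose-involutive : ∀ {n} j (i : Fin n) → transpose j (transpose j i) ≡ i
transpose-involutive {suc zero}    zero    fzero           = refl
transpose-involutive {suc (suc n)} zero    fzero           = refl
transpose-involutive {suc (suc n)} zero    (fsuc fzero)    = refl
transpose-involutive {suc (suc n)} zero    (fsuc (fsuc i)) = refl
transpose-involutive               (suc j) fzero           = refl
transpose-involutive               (suc j) (fsuc i)        = cong fsuc (transpose-involutive j i)

-- A transposition of two positions below m commutes with the embedding
-- Fin m ↪ Fin n; this is why h_T(x_{σ₁},…,x_{σ_m}) only sees swaps below m.
transpose-inject≤ : ∀ {m n} j (i : Fin m) (m≤n : m ≤ n) → suc j < m →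
                    transpose j (inject≤ i m≤n) ≡ inject≤ (transpose j i) m≤n
transpose-inject≤ {suc (suc m)} {suc (suc n)} zero fzero            _ _ = refl
transpose-inject≤ {suc (suc m)} {suc (suc n)} zero (fsuc fzero)     _ _ = refl
transpose-inject≤ {suc (suc m)} {suc (suc n)} zero (fsuc (fsuc i))  _ _ = refl
transpose-inject≤ {suc (suc m)} {suc zero}    zero i (s≤s ()) _
transpose-inject≤ {suc zero}                  zero i _ (s≤s ())
transpose-inject≤ {suc m} {suc n} (suc j) fzero    _   _       = refl
transpose-inject≤ {suc m} {suc n} (suc j) (fsuc i) m≤n (s≤s q) =
  cong fsuc (transpose-inject≤ j i (s≤s⁻¹ m≤n) q)

map-swapAt : ∀ {A B : Set} {n} (f : A → B) j (v : Vec A n) → Vec.map f (swapAt j v) ≡ swapAt j (Vec.map f v)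
map-swapAt f zero    []          = refl
map-swapAt f zero    (a ∷ [])    = refl
map-swapAt f zero    (a ∷ b ∷ v) = refl
map-swapAt f (suc j) []          = refl
map-swapAt f (suc j) (a ∷ v)     = cong (f a ∷_) (map-swapAt f j v)

sum-swapAt : ∀ {n} j (v : Vec ℕ n) → sum (swapAt j v) ≡ sum v
sum-swapAt zero    []          = refl
sum-swapAt zero    (a ∷ [])    = refl
sum-swapAt zero    (a ∷ b ∷ v) = +-left-comm b a (sum v)
sum-swapAt (suc j) []          = refl
sum-swapAt (suc j) (a ∷ v)     = cong (a +_) (sum-swapAt j v)

-- Positions of a composition indexed by ℕ (out-of-range positions read 0).
-- Goodness and the cancelling involution talk about positions d and d+1, which
-- is far more convenient with natural-number indices.

at : ∀ {n} → Vec ℕ n → ℕ → ℕ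
at []      i       = 0
at (a ∷ v) zero    = a
at (a ∷ v) (suc i) = at v i

lookup≡at : ∀ {n} (v : Vec ℕ n) (k : Fin n) → lookup v k ≡ at v (toℕ k)
lookup≡at (a ∷ v) fzero    = refl
lookup≡at (a ∷ v) (fsuc k) = lookup≡at v k

lookup-fromℕ< : ∀ {n i} (v : Vec ℕ n) (i<n : i < n) → lookup v (fromℕ< i<n) ≡ at v i
lookup-fromℕ< v i<n = trans (lookup≡at v (fromℕ< i<n)) (cong (at v) (FinP.toℕ-fromℕ< i<n))

at-swapAt-left : ∀ {n} j (v : Vec ℕ n) → suc j < n → at (swapAt j v) j ≡ at v (suc j)
at-swapAt-left zero    (a ∷ [])    (s≤s ())
at-swapAt-left zero    (a ∷ b ∷ v) _       = refl
at-swapAt-left (suc j) (a ∷ v)     (s≤s p) = at-swapAt-left j v p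

at-swapAt-right : ∀ {n} j (v : Vec ℕ n) → suc j < n → at (swapAt j v) (suc j) ≡ at v j
at-swapAt-right zero    (a ∷ [])    (s≤s ())
at-swapAt-right zero    (a ∷ b ∷ v) _       = refl
at-swapAt-right (suc j) (a ∷ v)     (s≤s p) = at-swapAt-right j v p

at-swapAt-other : ∀ {n} j (v : Vec ℕ n) i → i ≢ j → i ≢ suc j → at (swapAt j v) i ≡ at v i
at-swapAt-other zero    []          i             _   _   = refl
at-swapAt-other zero    (a ∷ [])    i             _   _   = refl
at-swapAt-other zero    (a ∷ b ∷ v) zero          i≢j _   = ⊥-elim (i≢j refl)
at-swapAt-other zero    (a ∷ b ∷ v) (suc zero)    _   i≢j = ⊥-elim (i≢j refl)
at-swapAt-other zero    (a ∷ b ∷ v) (suc (suc i)) _   _   = refl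
at-swapAt-other (suc j) []          i             _   _   = refl
at-swapAt-other (suc j) (a ∷ v)     zero          _   _   = refl
at-swapAt-other (suc j) (a ∷ v)     (suc i)       p   q   =
  at-swapAt-other j v i (λ e → p (cong suc e)) (λ e → q (cong suc e))

swapAt-equal : ∀ {n} j (v : Vec ℕ n) → at v j ≡ at v (suc j) → swapAt j v ≡ v
swapAt-equal zero    []          _ = refl
swapAt-equal zero    (a ∷ [])    _ = refl
swapAt-equal zero    (a ∷ b ∷ v) e = cong₂ (λ x y → x ∷ y ∷ v) (sym e) e
swapAt-equal (suc j) []          _ = refl
swapAt-equal (suc j) (a ∷ v)     e = cong (a ∷_) (swapAt-equal j v e)

-- This is the marking used for both cancelling involutions.
Ascent : ∀ {n} → ℕ → Vec ℕ n → Set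
Ascent j v = at v j < at v (suc j)

ascent? : ∀ {n} j (v : Vec ℕ n) → Dec (Ascent j v)
ascent? j v = at v j <? at v (suc j)

swapAt-ascent : ∀ {n} j (v : Vec ℕ n) → suc j < n → Ascent j v → ¬ Ascent j (swapAt j v)
swapAt-ascent j v j+1<n asc asc′ =
  <-asym asc (subst₂ _<_ (at-swapAt-left j v j+1<n) (at-swapAt-right j v j+1<n) asc′)

no-ascent-either-way : ∀ {n} j (v : Vec ℕ n) → suc j < n → ¬ Ascent j v → ¬ Ascent j (swapAt j v) → at v j ≡ at v (suc j)
no-ascent-either-way j v j+1<n ¬asc ¬asc′ = ≤-antisym
  (≮⇒≥ (λ lt → ¬asc′ (subst₂ _<_ (sym (at-swapAt-left j v j+1<n)) (sym (at-swapAt-right j v j+1<n)) lt)))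
  (≮⇒≥ ¬asc)

-- It agrees with the
-- pair count `inversions` of Defs, and an adjacent swap of an injective
-- vector changes it by exactly one, which is what makes the sign alternate.

countBelow : ∀ {m} → ℕ → Vec ℕ m → ℕ
countBelow a []      = 0
countBelow a (b ∷ v) = indicator (b <? a) + countBelow a v

inv : ∀ {m} → Vec ℕ m → ℕ
inv []      = 0
inv (a ∷ v) = countBelow a v + inv v

countFin-cong : ∀ {m} {f g : Fin m → ℕ} → (∀ i → f i ≡ g i) → countFin f ≡ countFin g
countFin-cong {zero}  _ = refl
countFin-cong {suc m} e = cong₂ _+_ (e fzero) (countFin-cong (λ i → e (fsuc i)))

indicator-cong : ∀ {P Q : Set} (p? : Dec P) (q? : Dec Q) → (P → Q) → (Q → P) → indicator p? ≡ indicator q?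
indicator-cong (yes p) (yes q) _ _ = refl
indicator-cong (yes p) (no ¬q) f _ = ⊥-elim (¬q (f p))
indicator-cong (no ¬p) (yes q) _ g = ⊥-elim (¬p (g q))
indicator-cong (no _)  (no _)  _ _ = refl

indicator-no : ∀ {P : Set} (p? : Dec P) → ¬ P → indicator p? ≡ 0
indicator-no (yes p) ¬p = ⊥-elim (¬p p)
indicator-no (no _)  _  = refl

indicator-yes : ∀ {P : Set} (p? : Dec P) → P → indicator p? ≡ 1
indicator-yes (yes _) _ = refl
indicator-yes (no ¬p) p = ⊥-elim (¬p p)

invPairs : ∀ {m} → Vec ℕ m → ℕ
invPairs {m} w = countFin λ (i : Fin m) → countFin λ (k : Fin m) →
  indicator ((toℕ i <? toℕ k) ×-dec (lookup w k <? lookup w i))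

invPairs≡inv : ∀ {m} (w : Vec ℕ m) → invPairs w ≡ inv w
invPairs≡inv []               = refl
invPairs≡inv {suc m} (a ∷ w) = cong₂ _+_ firstRow laterRows
  where
  countBelow-lookup : ∀ {m} (w : Vec ℕ m) → countFin (λ k → indicator (lookup w k <? a)) ≡ countBelow a w
  countBelow-lookup []      = refl
  countBelow-lookup (b ∷ w) = cong (indicator (b <? a) +_) (countBelow-lookup w)
  firstRow : countFin (λ (k : Fin (suc m)) →
               indicator ((0 <? toℕ k) ×-dec (lookup (a ∷ w) k <? a))) ≡ countBelow a w
  firstRow = trans
    (cong₂ _+_ (indicator-no ((0 <? 0) ×-dec (a <? a)) (λ { (() , _) }))
               (countFin-cong (λ k → indicator-cong ((0 <? suc (toℕ k)) ×-dec (lookup w k <? a))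
                                                    (lookup w k <? a) proj₂ (λ q → s≤s z≤n , q))))
    (countBelow-lookup w)
  laterRows : countFin (λ (i : Fin m) → countFin (λ (k : Fin (suc m)) →
                indicator ((suc (toℕ i) <? toℕ k) ×-dec (lookup (a ∷ w) k <? lookup w i)))) ≡ inv w
  laterRows = trans
    (countFin-cong (λ i → cong₂ _+_
      (indicator-no ((suc (toℕ i) <? 0) ×-dec (a <? lookup w i)) (λ { (() , _) }))
      (countFin-cong (λ k → indicator-cong
        ((suc (toℕ i) <? suc (toℕ k)) ×-dec (lookup w k <? lookup w i))
        ((toℕ i <? toℕ k) ×-dec (lookup w k <? lookup w i))
        (λ { (s≤s p , q) → p , q }) (λ { (p , q) → s≤s p , q })))))
    (invPairs≡inv w)

inversions≡inv : ∀ {n} (σ : Vec (Fin n) n) → inversions σ ≡ inv (Vec.map toℕ σ)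
inversions≡inv σ = trans
  (countFin-cong (λ i → countFin-cong (λ k →
    cong₂ (λ u v → indicator ((toℕ i <? toℕ k) ×-dec (u <? v)))
          (sym (VecP.lookup-map k toℕ σ)) (sym (VecP.lookup-map i toℕ σ)))))
  (invPairs≡inv (Vec.map toℕ σ))

Injective : ∀ {m} → Vec ℕ m → Set
Injective {m} w = ∀ (i k : Fin m) → lookup w i ≡ lookup w k → i ≡ k

countBelow-swapAt : ∀ {m} a j (w : Vec ℕ m) → countBelow a (swapAt j w) ≡ countBelow a w
countBelow-swapAt a zero    []          = refl
countBelow-swapAt a zero    (b ∷ [])    = refl
countBelow-swapAt a zero    (b ∷ c ∷ w) = +-left-comm (indicator (c <? a)) (indicator (b <? a)) (countBelow a w)
countBelow-swapAt a (suc j) []          = refl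
countBelow-swapAt a (suc j) (b ∷ w)     = cong (indicator (b <? a) +_) (countBelow-swapAt a j w)

inv-swap-heads : ∀ {m} a b (u : Vec ℕ m) → a < b → inv (b ∷ a ∷ u) ≡ suc (inv (a ∷ b ∷ u))
inv-swap-heads a b u a<b =
  begin
    (indicator (a <? b) + countBelow b u) + (countBelow a u + inv u)
  ≡⟨ cong (λ s → (s + countBelow b u) + (countBelow a u + inv u)) (indicator-yes (a <? b) a<b) ⟩
    (1 + countBelow b u) + (countBelow a u + inv u)
  ≡⟨ rearrange (countBelow b u) (countBelow a u) (inv u) ⟩
    suc ((0 + countBelow a u) + (countBelow b u + inv u))
  ≡⟨ cong (λ s → suc ((s + countBelow a u) + (countBelow b u + inv u))) (sym (indicator-no (b <? a) (<⇒≯ a<b))) ⟩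
    suc ((indicator (b <? a) + countBelow a u) + (countBelow b u + inv u))
  ∎
  where
  open ≡-Reasoning
  rearrange : ∀ X Y Z → (1 + X) + (Y + Z) ≡ suc ((0 + Y) + (X + Z))
  rearrange = solve-∀

inv-swapAt : ∀ {m} j (w : Vec ℕ m) → suc j < m → Injective w →
             (inv (swapAt j w) ≡ suc (inv w)) ⊎ (inv w ≡ suc (inv (swapAt j w)))
inv-swapAt zero (a ∷ []) (s≤s ()) _
inv-swapAt zero (a ∷ b ∷ u) _ inj with <-cmp a b
... | tri< a<b _ _ = inj₁ (inv-swap-heads a b u a<b)
... | tri≈ _ a≡b _ = ⊥-elim (FinP.0≢1+n (inj fzero (fsuc fzero) a≡b))
... | tri> _ _ b<a = inj₂ (inv-swap-heads b a u b<a)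
inv-swapAt (suc j) (a ∷ w) (s≤s p) inj with inv-swapAt j w p (λ i k e → FinP.suc-injective (inj (fsuc i) (fsuc k) e))
... | inj₁ e = inj₁ (trans (cong₂ _+_ (countBelow-swapAt a j w) e) (+-suc _ _))
... | inj₂ e = inj₂ (trans (cong₂ _+_ (sym (countBelow-swapAt a j w)) e) (+-suc _ _))

perm-injective : ∀ {n} (σ : Vec (Fin n) n) → IsPerm σ → Injective (Vec.map toℕ σ)
perm-injective σ isPerm i k e =
  isPerm i k (FinP.toℕ-injective (trans (sym (VecP.lookup-map i toℕ σ)) (trans e (VecP.lookup-map k toℕ σ))))

injective-at : ∀ {m} (w : Vec ℕ m) → Injective w → ∀ j → suc j < m → at w j ≢ at w (suc j)
injective-at {m} w inj j j+1<m w-j≡w-j+1 = 1+n≢n (sym (begin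
    j                          ≡⟨ sym (FinP.toℕ-fromℕ< j<m) ⟩
    toℕ (fromℕ< j<m)           ≡⟨ cong toℕ (inj (fromℕ< j<m) (fromℕ< j+1<m) same-value) ⟩
    toℕ (fromℕ< j+1<m)         ≡⟨ FinP.toℕ-fromℕ< j+1<m ⟩
    suc j                      ∎))
  where
  open ≡-Reasoning
  j<m : j < m
  j<m = <-trans (n<1+n j) j+1<m
  same-value : lookup w (fromℕ< j<m) ≡ lookup w (fromℕ< j+1<m)
  same-value = trans (lookup-fromℕ< w j<m) (trans w-j≡w-j+1 (sym (lookup-fromℕ< w j+1<m)))

inversions-swapAt : ∀ {n} j (σ : Vec (Fin n) n) → IsPerm σ → suc j < n →
                    (inversions (swapAt j σ) ≡ suc (inversions σ)) ⊎ (inversions σ ≡ suc (inversions (swapAt j σ)))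
inversions-swapAt j σ isPerm j+1<n with inv-swapAt j (Vec.map toℕ σ) j+1<n (perm-injective σ isPerm)
... | inj₁ one-more = inj₁ (begin
      inversions (swapAt j σ)            ≡⟨ inversions≡inv (swapAt j σ) ⟩
      inv (Vec.map toℕ (swapAt j σ))     ≡⟨ cong inv (map-swapAt toℕ j σ) ⟩
      inv (swapAt j (Vec.map toℕ σ))     ≡⟨ one-more ⟩
      suc (inv (Vec.map toℕ σ))          ≡⟨ cong suc (sym (inversions≡inv σ)) ⟩
      suc (inversions σ)                 ∎)
  where open ≡-Reasoning
... | inj₂ one-less = inj₂ (begin
      inversions σ                       ≡⟨ inversions≡inv σ ⟩
      inv (Vec.map toℕ σ)                ≡⟨ one-less ⟩
      suc (inv (swapAt j (Vec.map toℕ σ))) ≡⟨ cong (suc ∘ inv) (sym (map-swapAt toℕ j σ)) ⟩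
      suc (inv (Vec.map toℕ (swapAt j σ))) ≡⟨ cong suc (sym (inversions≡inv (swapAt j σ))) ⟩
      suc (inversions (swapAt j σ))      ∎)
  where open ≡-Reasoning

perm-swapAt : ∀ {n} j (σ : Vec (Fin n) n) → IsPerm σ → IsPerm (swapAt j σ)
perm-swapAt j σ isPerm i k e =
  trans (sym (transpose-involutive j i))
    (trans (cong (transpose j) (isPerm (transpose j i) (transpose j k)
             (trans (sym (lookup-swapAt j σ i)) (trans e (lookup-swapAt j σ k)))))
           (transpose-involutive j k))

perm-unswapAt : ∀ {n} j (σ : Vec (Fin n) n) → IsPerm (swapAt j σ) → IsPerm σ
perm-unswapAt j σ isPerm = subst IsPerm (swapAt-involutive j σ) (perm-swapAt j (swapAt j σ) isPerm)

-- Compositions.  `pad` extends a composition of length c ≤ n by zeros, and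
-- `_⊕_` is entrywise addition; μ ⊕ pad e is μ raised by e in its first c
-- parts, which is how a monomial of h_T(x_{σ₁},…,x_{σ_c}) enters the exponent.

pad : ∀ {c n} → c ≤ n → Vec ℕ c → Vec ℕ n
pad {n = n} z≤n     []      = replicate n 0
pad         (s≤s p) (a ∷ e) = a ∷ pad p e

_⊕_ : ∀ {n} → Vec ℕ n → Vec ℕ n → Vec ℕ n
_⊕_ = zipWith _+_

sum-pad : ∀ {c n} (p : c ≤ n) (e : Vec ℕ c) → sum (pad p e) ≡ sum e
sum-pad {n = n} z≤n     []      = sum-zeros n
  where sum-zeros : ∀ n → sum (replicate n 0) ≡ 0
        sum-zeros zero    = refl
        sum-zeros (suc n) = sum-zeros n
sum-pad         (s≤s p) (a ∷ e) = cong (a +_) (sum-pad p e)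

sum-⊕ : ∀ {n} (μ β : Vec ℕ n) → sum (μ ⊕ β) ≡ sum μ + sum β
sum-⊕ []      []      = refl
sum-⊕ (a ∷ μ) (b ∷ β) = trans (cong ((a + b) +_) (sum-⊕ μ β)) (+-interchange a b (sum μ) (sum β))

⊕-zeros : ∀ {n} (μ : Vec ℕ n) → μ ⊕ replicate n 0 ≡ μ
⊕-zeros []      = refl
⊕-zeros (a ∷ μ) = cong₂ _∷_ (ℕP.+-identityʳ a) (⊕-zeros μ)

lookup≤sum : ∀ {n} (μ : Vec ℕ n) k → lookup μ k ≤ sum μ
lookup≤sum (a ∷ μ) fzero    = m≤m+n a (sum μ)
lookup≤sum (a ∷ μ) (fsuc k) = ≤-trans (lookup≤sum μ k) (m≤n+m (sum μ) a)

_⊇_ : ∀ {n} → Vec ℕ n → Vec ℕ n → Set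
α ⊇ μ = ∀ k → lookup μ k ≤ lookup α k

sum-mono : ∀ {n} (μ α : Vec ℕ n) → α ⊇ μ → sum μ ≤ sum α
sum-mono []      []      _   = z≤n
sum-mono (m ∷ μ) (a ∷ α) α⊇μ = +-mono-≤ (α⊇μ fzero) (sum-mono μ α (λ k → α⊇μ (fsuc k)))

part-growth : ∀ {n} (μ α : Vec ℕ n) → α ⊇ μ → ∀ k → lookup α k + sum μ ≤ lookup μ k + sum α
part-growth (m ∷ μ) (a ∷ α) α⊇μ fzero =
  subst (_≤ m + (a + sum α)) (sym (+-left-comm a m (sum μ)))
        (+-monoʳ-≤ m (+-monoʳ-≤ a (sum-mono μ α (λ k → α⊇μ (fsuc k)))))
part-growth (m ∷ μ) (a ∷ α) α⊇μ (fsuc k) =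
  subst₂ _≤_ (sym (+-left-comm (lookup α k) m (sum μ))) (+-left-comm a (lookup μ k) (sum α))
         (+-mono-≤ (α⊇μ fzero) (part-growth μ α (λ k → α⊇μ (fsuc k)) k))

part-bound : ∀ {n} (μ α : Vec ℕ n) T → α ⊇ μ → sum α ≡ sum μ + T → ∀ k → lookup α k ≤ lookup μ k + T
part-bound μ α T α⊇μ |α| k = +-cancelʳ-≤ (sum μ) _ _
  (subst (lookup α k + sum μ ≤_) (trans (cong (lookup μ k +_) |α|) (rearrange (lookup μ k) (sum μ) T))
         (part-growth μ α α⊇μ k))
  where rearrange : ∀ a b c → a + (b + c) ≡ (a + c) + b
        rearrange = solve-∀

-- One step of a T-extension, and its goodness.  These are the conditions
-- StepOK / GoodStep of Defs for a single pair μ = λ^{h-1}, α = λ^h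
-- (definitionally so), with c = c_h and T = T_h.

IsStep : ∀ {n} → ℕ → ℕ → Vec ℕ n → Vec ℕ n → Set
IsStep c T μ α = α ⊇ μ × (sum α ≡ sum μ + T) × (∀ k → c ≤ toℕ k → lookup α k ≡ lookup μ k)

isStep? : ∀ {n} c T (μ α : Vec ℕ n) → Dec (IsStep c T μ α)
isStep? c T μ α = FinP.all? (λ k → lookup μ k ≤? lookup α k) ×-dec (sum α ≟ sum μ + T)
  ×-dec FinP.all? (λ k → (c ≤? toℕ k) →-dec (lookup α k ≟ lookup μ k))

IsGoodStep : ∀ {n} → ℕ → Vec ℕ n → Vec ℕ n → Set
IsGoodStep {n} c μ α = ∀ (j k : Fin n) → toℕ k ≡ suc (toℕ j) → toℕ k < c → lookup α k < lookup μ j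

isGoodStep? : ∀ {n} c (μ α : Vec ℕ n) → Dec (IsGoodStep c μ α)
isGoodStep? c μ α = FinP.all? λ j → FinP.all? λ k →
  (toℕ k ≟ suc (toℕ j)) →-dec ((toℕ k <? c) →-dec (lookup α k <? lookup μ j))

GoodFrom : ∀ {n} → ℕ → Vec ℕ n → ℕ → Vec ℕ n → Set
GoodFrom {n} c μ d α = ∀ (j k : Fin n) → toℕ k ≡ suc (toℕ j) → d ≤ toℕ j → toℕ k < c → lookup α k < lookup μ j

goodFrom? : ∀ {n} c (μ : Vec ℕ n) d α → Dec (GoodFrom c μ d α)
goodFrom? c μ d α = FinP.all? λ j → FinP.all? λ k → (toℕ k ≟ suc (toℕ j)) →-dec
  ((d ≤? toℕ j) →-dec ((toℕ k <? c) →-dec (lookup α k <? lookup μ j)))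

GoodAt : ∀ {n} → ℕ → Vec ℕ n → ℕ → Vec ℕ n → Set
GoodAt {n} c μ d α = ∀ (j k : Fin n) → toℕ j ≡ d → toℕ k ≡ suc d → toℕ k < c → lookup α k < lookup μ j

goodAt? : ∀ {n} c (μ : Vec ℕ n) d α → Dec (GoodAt c μ d α)
goodAt? c μ d α = FinP.all? λ j → FinP.all? λ k → (toℕ j ≟ d) →-dec
  ((toℕ k ≟ suc d) →-dec ((toℕ k <? c) →-dec (lookup α k <? lookup μ j)))

GoodFrom-zero⇔ : ∀ {n} c (μ α : Vec ℕ n) → (GoodFrom c μ 0 α → IsGoodStep c μ α) × (IsGoodStep c μ α → GoodFrom c μ 0 α)
GoodFrom-zero⇔ c μ α = (λ good j k e k<c → good j k e z≤n k<c) , (λ good j k e _ k<c → good j k e k<c)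

GoodFrom-vacuous : ∀ {n} c (μ α : Vec ℕ n) → GoodFrom c μ c α
GoodFrom-vacuous c μ α j k k≡1+j c≤j k<c =
  ⊥-elim (<-irrefl refl (≤-trans k<c (≤-trans c≤j (≤-trans (n≤1+n (toℕ j)) (≤-reflexive (sym k≡1+j))))))

GoodFrom-split : ∀ {n} c (μ : Vec ℕ n) d α → (GoodFrom c μ d α → GoodFrom c μ (suc d) α × GoodAt c μ d α)
                                            × (GoodFrom c μ (suc d) α × GoodAt c μ d α → GoodFrom c μ d α)
GoodFrom-split c μ d α = split , join
  where
  split : GoodFrom c μ d α → GoodFrom c μ (suc d) α × GoodAt c μ d α
  split good = (λ j k e d<j k<c → good j k e (≤-trans (n≤1+n d) d<j) k<c)
             , (λ j k j≡d k≡1+d k<c → good j k (trans k≡1+d (cong suc (sym j≡d))) (≤-reflexive (sym j≡d)) k<c)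
  join : GoodFrom c μ (suc d) α × GoodAt c μ d α → GoodFrom c μ d α
  join (good , goodAt) j k e d≤j k<c with d ≟ toℕ j
  ... | yes d≡j = goodAt j k (sym d≡j) (trans e (cong suc (sym d≡j))) k<c
  ... | no d≢j  = good j k e (≤∧≢⇒< d≤j d≢j) k<c

GoodAt-vacuous : ∀ {n} c (μ : Vec ℕ n) d α → ¬ (suc d < c) → GoodAt c μ d α
GoodAt-vacuous c μ d α d+1≮c j k _ k≡1+d k<c = ⊥-elim (d+1≮c (subst (_< c) k≡1+d k<c))

¬GoodAt⇒≥ : ∀ {n} c (μ : Vec ℕ n) d α → ¬ GoodAt c μ d α → at μ d ≤ at α (suc d)
¬GoodAt⇒≥ c μ d α bad = ≮⇒≥ λ lt → bad (λ j k j≡d k≡1+d _ →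
  subst₂ _<_ (sym (trans (lookup≡at α k) (cong (at α) k≡1+d)))
             (sym (trans (lookup≡at μ j) (cong (at μ) j≡d))) lt)

Strict : ∀ {n} → Vec ℕ n → Set
Strict {n} μ = ∀ (i j : Fin n) → toℕ i < toℕ j → lookup μ j < lookup μ i

strict-at : ∀ {n} (μ : Vec ℕ n) → Strict μ → ∀ i j → i < j → j < n → at μ j < at μ i
strict-at μ strict i j i<j j<n = subst₂ _<_ (lookup-fromℕ< μ j<n) (lookup-fromℕ< μ (<-trans i<j j<n))
  (strict (fromℕ< (<-trans i<j j<n)) (fromℕ< j<n)
          (subst₂ _<_ (sym (FinP.toℕ-fromℕ< (<-trans i<j j<n))) (sym (FinP.toℕ-fromℕ< j<n)) i<j))

strict-at-antitone : ∀ {n} (μ : Vec ℕ n) → Strict μ → ∀ i j → i ≤ j → j < n → at μ j ≤ at μ i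
strict-at-antitone μ strict i j i≤j j<n with m≤n⇒m<n∨m≡n i≤j
... | inj₁ i<j = <⇒≤ (strict-at μ strict i j i<j j<n)
... | inj₂ i≡j = ≤-reflexive (cong (at μ) (sym i≡j))

-- A good step from a strict partition again yields a strict partition:
-- inside the first c positions α_{j+1} < μ_j ≤ α_j, beyond them α = μ.
strict-step : ∀ {n} c T (μ α : Vec ℕ n) → c ≤ n → Strict μ → IsStep c T μ α → IsGoodStep c μ α → Strict α
strict-step {n} c T μ α c≤n strict (α⊇μ , _ , fixed) good i j i<j with toℕ j <? c
... | no j≮c = <-≤-trans (subst (_< lookup μ i) (sym (fixed j (≮⇒≥ j≮c))) (strict i j i<j)) (α⊇μ i)
... | yes j<c = below-c (toℕ j) refl
  where
  below-c : ∀ J → toℕ j ≡ J → lookup α j < lookup α i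
  below-c zero    j≡0  = ⊥-elim (<⇒≱ i<j (subst (_≤ toℕ i) (sym j≡0) z≤n))
  below-c (suc J) j≡1+J = <-≤-trans (good (fromℕ< J<n) j (trans j≡1+J (cong suc (sym (FinP.toℕ-fromℕ< J<n)))) j<c)
    (≤-trans (subst₂ _≤_ (sym (lookup-fromℕ< μ J<n)) (sym (lookup≡at μ i))
                     (strict-at-antitone μ strict (toℕ i) J (s≤s⁻¹ (subst (toℕ i <_) j≡1+J i<j)) J<n))
             (α⊇μ i))
    where
    J<n : J < n
    J<n = <-trans (n<1+n J) (subst (_< n) j≡1+J (FinP.toℕ<n j))

-- The extensions whose goodness holds after position d but fails at d.
-- Their contributions cancel in pairs under the swap of positions d, d+1.
FailsFirstAt : ∀ {n} → ℕ → ℕ → Vec ℕ n → ℕ → Vec ℕ n → Set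
FailsFirstAt c T μ d α = (IsStep c T μ α × GoodFrom c μ (suc d) α) × ¬ GoodAt c μ d α

failsFirstAt? : ∀ {n} c T (μ : Vec ℕ n) d α → Dec (FailsFirstAt c T μ d α)
failsFirstAt? c T μ d α = (isStep? c T μ α ×-dec goodFrom? c μ (suc d) α) ×-dec ¬? (goodAt? c μ d α)

-- It
-- stays a step extension because μ_{d+1} < μ_d ≤ α_{d+1} (failure at d), and
-- goodness at the untouched positions after d is unaffected.
swapAt-FailsFirstAt : ∀ {n} c T (μ : Vec ℕ n) d (α : Vec ℕ n) → c ≤ n → Strict μ → suc d < c →
                      FailsFirstAt c T μ d α → FailsFirstAt c T μ d (swapAt d α)
swapAt-FailsFirstAt {n} c T μ d α c≤n strict d+1<c ((( α⊇μ , |α| , fixed) , good) , bad) =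
  ((α'⊇μ , trans (sum-swapAt d α) |α| , fixed') , good') , bad'
  where
  α' = swapAt d α
  d+1<n : suc d < n
  d+1<n = <-≤-trans d+1<c c≤n
  d<n : d < n
  d<n = <-trans (n<1+n d) d+1<n
  at-α' : ∀ k → toℕ k ≢ d → toℕ k ≢ suc d → lookup α' k ≡ lookup α k
  at-α' k k≢d k≢1+d = trans (lookup≡at α' k) (trans (at-swapAt-other d α (toℕ k) k≢d k≢1+d) (sym (lookup≡at α k)))
  beyond : ∀ k → suc d < toℕ k → lookup α' k ≡ lookup α k
  beyond k d+1<k = at-α' k (λ e → <-irrefl (sym e) (<-trans (n<1+n d) d+1<k)) (λ e → <-irrefl (sym e) d+1<k)
  α⊇μ-at : ∀ i → i < n → at μ i ≤ at α i
  α⊇μ-at i i<n = subst₂ _≤_ (lookup-fromℕ< μ i<n) (lookup-fromℕ< α i<n) (α⊇μ (fromℕ< i<n))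
  α'⊇μ : α' ⊇ μ
  α'⊇μ k with toℕ k ≟ d
  ... | yes k≡d = subst₂ _≤_ (sym (trans (lookup≡at μ k) (cong (at μ) k≡d)))
                             (sym (trans (lookup≡at α' k) (trans (cong (at α') k≡d) (at-swapAt-left d α d+1<n))))
                             (¬GoodAt⇒≥ c μ d α bad)
  ... | no k≢d with toℕ k ≟ suc d
  ...   | yes k≡1+d = subst₂ _≤_ (sym (trans (lookup≡at μ k) (cong (at μ) k≡1+d)))
                                 (sym (trans (lookup≡at α' k) (trans (cong (at α') k≡1+d) (at-swapAt-right d α d+1<n))))
                                 (≤-trans (<⇒≤ (strict-at μ strict d (suc d) (n<1+n d) d+1<n)) (α⊇μ-at d d<n))
  ...   | no k≢1+d = subst (lookup μ k ≤_) (sym (at-α' k k≢d k≢1+d)) (α⊇μ k)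
  fixed' : ∀ k → c ≤ toℕ k → lookup α' k ≡ lookup μ k
  fixed' k c≤k = trans (beyond k (<-≤-trans d+1<c c≤k)) (fixed k c≤k)
  good' : GoodFrom c μ (suc d) α'
  good' j k k≡1+j d<j k<c =
    subst (_< lookup μ j) (sym (beyond k (subst (suc d <_) (sym k≡1+j) (s≤s d<j)))) (good j k k≡1+j d<j k<c)
  bad' : ¬ GoodAt c μ d α'
  bad' goodAt = <⇒≱ (subst₂ _<_ (trans (lookup-fromℕ< α' d+1<n) (at-swapAt-right d α d+1<n)) (lookup-fromℕ< μ d<n)
                       (goodAt (fromℕ< d<n) (fromℕ< d+1<n) (FinP.toℕ-fromℕ< d<n) (FinP.toℕ-fromℕ< d+1<n)
                               (subst (_< c) (sym (FinP.toℕ-fromℕ< d+1<n)) d+1<c)))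
                    (α⊇μ-at d d<n)

Bounded : ∀ {n} → ℕ → Vec ℕ n → Set
Bounded N []      = ⊤
Bounded N (a ∷ v) = a < N × Bounded N v

bounded? : ∀ {n} N (v : Vec ℕ n) → Dec (Bounded N v)
bounded? N []      = yes tt
bounded? N (a ∷ v) = (a <? N) ×-dec bounded? N v

bounded : ∀ {n} N (v : Vec ℕ n) → (∀ k → lookup v k < N) → Bounded N v
bounded N []      _ = tt
bounded N (a ∷ v) v<N = v<N fzero , bounded N v (λ k → v<N (fsuc k))

-- The box μ_k ≤ α_k ≤ μ_k + T (k < c), α_k = μ_k (k ≥ c), written so that it
-- factors over the coordinates: it is the image of e ↦ μ ⊕ pad e for e ∈ [0,T]^c.
InBox : ∀ {c n} → c ≤ n → ℕ → Vec ℕ n → Vec ℕ n → Set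
InBox z≤n     T μ       α       = α ≡ μ
InBox (s≤s p) T (m ∷ μ) (a ∷ α) = ((m ≤ a) × (a ≤ m + T)) × InBox p T μ α

inBox? : ∀ {c n} (p : c ≤ n) T μ α → Dec (InBox p T μ α)
inBox? z≤n     T μ       α       = VecP.≡-dec _≟_ α μ
inBox? (s≤s p) T (m ∷ μ) (a ∷ α) = ((m ≤? a) ×-dec (a ≤? m + T)) ×-dec inBox? p T μ α

InBox⇒⊇ : ∀ {c n} (p : c ≤ n) T μ α → InBox p T μ α → α ⊇ μ
InBox⇒⊇ z≤n     T μ       α       refl       k        = ≤-refl
InBox⇒⊇ (s≤s p) T (m ∷ μ) (a ∷ α) ((m≤a , _) , _) fzero = m≤a
InBox⇒⊇ (s≤s p) T (m ∷ μ) (a ∷ α) (_ , box) (fsuc k)  = InBox⇒⊇ p T μ α box k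

InBox⇒fixed : ∀ {c n} (p : c ≤ n) T μ α → InBox p T μ α → ∀ k → c ≤ toℕ k → lookup α k ≡ lookup μ k
InBox⇒fixed z≤n     T μ       α       refl      k        _       = refl
InBox⇒fixed (s≤s p) T (m ∷ μ) (a ∷ α) (_ , box) (fsuc k) (s≤s q) = InBox⇒fixed p T μ α box k q

⇒InBox : ∀ {c n} (p : c ≤ n) T μ α → α ⊇ μ → (∀ k → c ≤ toℕ k → lookup α k ≡ lookup μ k) →
         (∀ k → lookup α k ≤ lookup μ k + T) → InBox p T μ α
⇒InBox z≤n     T []      []      _   _     _     = refl
⇒InBox z≤n     T (m ∷ μ) (a ∷ α) α⊇μ fixed above =
  cong₂ _∷_ (fixed fzero z≤n)
            (⇒InBox z≤n T μ α (λ k → α⊇μ (fsuc k)) (λ k _ → fixed (fsuc k) z≤n) (λ k → above (fsuc k)))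
⇒InBox (s≤s p) T (m ∷ μ) (a ∷ α) α⊇μ fixed above =
  (α⊇μ fzero , above fzero) , ⇒InBox p T μ α (λ k → α⊇μ (fsuc k)) (λ k q → fixed (fsuc k) (s≤s q)) (λ k → above (fsuc k))

step⇔InBox : ∀ {c n} (p : c ≤ n) T (μ α : Vec ℕ n) →
             (InBox p T μ α × (sum α ≡ sum μ + T) → IsStep c T μ α) × (IsStep c T μ α → InBox p T μ α × (sum α ≡ sum μ + T))
step⇔InBox p T μ α =
  (λ (box , |α|) → InBox⇒⊇ p T μ α box , |α| , InBox⇒fixed p T μ α box) ,
  (λ (α⊇μ , |α| , fixed) → ⇒InBox p T μ α α⊇μ fixed (part-bound μ α T α⊇μ |α|) , |α|)

module _ {n ℓ : ℕ} (c T : Fin (suc ℓ) → ℕ) (μ a : Vec ℕ n) (Λ : Vec (Vec ℕ n) (suc ℓ)) where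

  FirstStepThenRest : Set
  FirstStepThenRest = (a ≡ μ) × ((IsStep (c fzero) (T fzero) μ (lookup Λ fzero) × IsGoodStep (c fzero) μ (lookup Λ fzero))
                                 × IsGoodTExtension (λ h → c (fsuc h)) (λ h → T (fsuc h)) (lookup Λ fzero) Λ)

  goodTExtension⇒firstStep : IsGoodTExtension c T μ (a ∷ Λ) → FirstStepThenRest
  goodTExtension⇒firstStep ((refl , steps) , good) =
    refl , (steps fzero , good fzero) , ((refl , λ h → steps (fsuc h)) , λ h → good (fsuc h))

  firstStep⇒goodTExtension : FirstStepThenRest → IsGoodTExtension c T μ (a ∷ Λ)
  firstStep⇒goodTExtension (refl , (step₁ , good₁) , ((_ , steps) , good)) = (refl , steps′) , good′
    where
    steps′ : ∀ h → StepOK c T μ (μ ∷ Λ) h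
    steps′ fzero    = step₁
    steps′ (fsuc h) = steps h
    good′ : ∀ h → GoodStep c T μ (μ ∷ Λ) h
    good′ fzero    = good₁
    good′ (fsuc h) = good h

module _ {n ℓ : ℕ} (c T : Fin ℓ → ℕ) (α : Vec ℕ n) (Λ : Vec (Vec ℕ n) (suc ℓ)) where

  goodTExtension⇒head : IsGoodTExtension c T α Λ → (α ≡ lookup Λ fzero) × IsGoodTExtension c T (lookup Λ fzero) Λ
  goodTExtension⇒head ((λ⁰≡α , steps) , good) = sym λ⁰≡α , ((refl , steps) , good)

  head⇒goodTExtension : (α ≡ lookup Λ fzero) × IsGoodTExtension c T (lookup Λ fzero) Λ → IsGoodTExtension c T α Λ
  head⇒goodTExtension (α≡λ⁰ , ((_ , steps) , good)) = (sym α≡λ⁰ , steps) , good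

-- `sumFin` of Defs carries the module parameters c, T, μ without using them.
sumFin-irrelevant : ∀ {n ℓ n′ ℓ′} (c T : Fin ℓ → ℕ) (μ : Vec ℕ n) (c′ T′ : Fin ℓ′ → ℕ) (μ′ : Vec ℕ n′) {m} (g : Fin m → ℕ) →
                    sumFin c T μ g ≡ sumFin c′ T′ μ′ g
sumFin-irrelevant c T μ c′ T′ μ′ {zero}  g = refl
sumFin-irrelevant c T μ c′ T′ μ′ {suc m} g = cong (g fzero +_) (sumFin-irrelevant c T μ c′ T′ μ′ (λ i → g (fsuc i)))

module Expansion {a r : Level} (R : CommutativeRing a r) where

  open CommutativeRing R
    renaming (refl to ≈-refl; sym to ≈-sym; trans to ≈-trans; _+_ to _+ᴿ_; _*_ to _*ᴿ_)
  open RingDefs R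
  open import Algebra.Properties.Ring ring using (-‿distribˡ-*; -‿distribʳ-*; -‿involutive; -‿+-comm; -0#≈0#)
  open import Algebra.Properties.CommutativeSemigroup +-commutativeSemigroup
    using () renaming (interchange to +ᴿ-interchange)
  open import Algebra.Properties.CommutativeSemigroup *-commutativeSemigroup
    using () renaming (interchange to *ᴿ-interchange; x∙yz≈y∙xz to *ᴿ-left-comm)
  open import Relation.Binary.Reasoning.Setoid setoid

  sumOver : ∀ {A : Set} → List A → (A → Carrier) → Carrier
  sumOver xs f = sumL (map f xs)

  sumOver-cong : ∀ {A : Set} (xs : List A) {f g : A → Carrier} → (∀ x → f x ≈ g x) → sumOver xs f ≈ sumOver xs g
  sumOver-cong []       _   = ≈-refl
  sumOver-cong (x ∷ xs) f≈g = +-cong (f≈g x) (sumOver-cong xs f≈g)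

  sumOver-++ : ∀ {A : Set} (xs ys : List A) f → sumOver (xs ++ ys) f ≈ sumOver xs f +ᴿ sumOver ys f
  sumOver-++ []       ys f = ≈-sym (+-identityˡ _)
  sumOver-++ (x ∷ xs) ys f = ≈-trans (+-congˡ (sumOver-++ xs ys f)) (≈-sym (+-assoc _ _ _))

  sumOver-concatMap : ∀ {A B : Set} (g : A → List B) (xs : List A) f →
                      sumOver (concatMap g xs) f ≈ sumOver xs (λ a → sumOver (g a) f)
  sumOver-concatMap g []       f = ≈-refl
  sumOver-concatMap g (x ∷ xs) f = ≈-trans (sumOver-++ (g x) (concatMap g xs) f) (+-congˡ (sumOver-concatMap g xs f))

  sumOver-map : ∀ {A B : Set} (g : A → B) (xs : List A) f → sumOver (map g xs) f ≡ sumOver xs (λ a → f (g a))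
  sumOver-map g []       f = refl
  sumOver-map g (x ∷ xs) f = cong (f (g x) +ᴿ_) (sumOver-map g xs f)

  sumOver-+ : ∀ {A : Set} (xs : List A) f g → sumOver xs (λ a → f a +ᴿ g a) ≈ sumOver xs f +ᴿ sumOver xs g
  sumOver-+ []       f g = ≈-sym (+-identityˡ 0#)
  sumOver-+ (x ∷ xs) f g = ≈-trans (+-congˡ (sumOver-+ xs f g)) (+ᴿ-interchange (f x) (g x) _ _)

  *-sumOver : ∀ {A : Set} c (xs : List A) f → c *ᴿ sumOver xs f ≈ sumOver xs (λ a → c *ᴿ f a)
  *-sumOver c []       f = zeroʳ c
  *-sumOver c (x ∷ xs) f = ≈-trans (distribˡ c _ _) (+-congˡ (*-sumOver c xs f))

  sumOver-* : ∀ {A : Set} c (xs : List A) f → sumOver xs f *ᴿ c ≈ sumOver xs (λ a → f a *ᴿ c)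
  sumOver-* c xs f = ≈-trans (*-comm _ c) (≈-trans (*-sumOver c xs f) (sumOver-cong xs (λ a → *-comm c (f a))))

  sumOver-zero : ∀ {A : Set} (xs : List A) f → (∀ a → f a ≈ 0#) → sumOver xs f ≈ 0#
  sumOver-zero []       f f≈0 = ≈-refl
  sumOver-zero (x ∷ xs) f f≈0 = ≈-trans (+-cong (f≈0 x) (sumOver-zero xs f f≈0)) (+-identityˡ 0#)

  sumOver-neg : ∀ {A : Set} (xs : List A) f → sumOver xs (λ a → - f a) ≈ - sumOver xs f
  sumOver-neg []       f = ≈-sym -0#≈0#
  sumOver-neg (x ∷ xs) f = ≈-trans (+-congˡ (sumOver-neg xs f)) (-‿+-comm _ _)

  fubini : ∀ {A B : Set} (xs : List A) (ys : List B) (f : A → B → Carrier) →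
           sumOver xs (λ a → sumOver ys (λ b → f a b)) ≈ sumOver ys (λ b → sumOver xs (λ a → f a b))
  fubini []       ys f = ≈-sym (sumOver-zero ys _ (λ _ → ≈-refl))
  fubini (x ∷ xs) ys f =
    ≈-trans (+-congˡ (fubini xs ys f)) (≈-sym (sumOver-+ ys (f x) (λ b → sumOver xs (λ a → f a b))))

  [_] : ∀ {P : Set} → Dec P → Carrier
  [ p? ] = if does p? then 1# else 0#

  [yes] : ∀ {P : Set} (p? : Dec P) → P → [ p? ] ≡ 1#
  [yes] (yes _) _ = refl
  [yes] (no ¬p) p = ⊥-elim (¬p p)

  [no] : ∀ {P : Set} (p? : Dec P) → ¬ P → [ p? ] ≡ 0#
  [no] (yes p) ¬p = ⊥-elim (¬p p)
  [no] (no _)  _  = refl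

  [no]* : ∀ {P : Set} (p? : Dec P) → ¬ P → ∀ x → [ p? ] *ᴿ x ≈ 0#
  [no]* p? ¬p x = ≈-trans (*-congʳ (reflexive ([no] p? ¬p))) (zeroˡ x)

  [yes]* : ∀ {P : Set} (p? : Dec P) → P → ∀ x → [ p? ] *ᴿ x ≈ x
  [yes]* p? p x = ≈-trans (*-congʳ (reflexive ([yes] p? p))) (*-identityˡ x)

  [⇔] : ∀ {P Q : Set} (p? : Dec P) (q? : Dec Q) → (P → Q) → (Q → P) → [ p? ] ≡ [ q? ]
  [⇔] (yes p) q? f g = ≡.sym ([yes] q? (f p))
  [⇔] (no ¬p) q? f g = ≡.sym ([no] q? (λ q → ¬p (g q)))

  [×] : ∀ {P Q : Set} (p? : Dec P) (q? : Dec Q) → [ p? ×-dec q? ] ≈ [ p? ] *ᴿ [ q? ]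
  [×] (yes p) (yes q) = ≈-sym (*-identityˡ 1#)
  [×] (yes p) (no q)  = ≈-sym (zeroʳ 1#)
  [×] (no p)  q?      = ≈-sym (zeroˡ _)

  [split] : ∀ {P Q : Set} (p? : Dec P) (q? : Dec Q) → [ p? ] ≈ [ p? ×-dec q? ] +ᴿ [ p? ×-dec ¬? q? ]
  [split] (no _)  q?      = ≈-sym (+-identityˡ _)
  [split] (yes _) (yes _) = ≈-sym (+-identityʳ _)
  [split] (yes _) (no _)  = ≈-sym (+-identityˡ _)

  [guard] : ∀ {P : Set} (p? : Dec P) {x y} → (P → x ≈ y) → [ p? ] *ᴿ x ≈ [ p? ] *ᴿ y
  [guard] (yes p) x≈y = *-congˡ (x≈y p)
  [guard] (no _)  _   = ≈-trans (zeroˡ _) (≈-sym (zeroˡ _))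

  [absorb] : ∀ {P Q : Set} (p? : Dec P) (q? : Dec Q) x → (Q → P) → [ p? ] *ᴿ ([ q? ] *ᴿ x) ≈ [ q? ] *ᴿ x
  [absorb] p? (yes q) x q⇒p = [yes]* p? (q⇒p q) _
  [absorb] p? (no ¬q) x _   = ≈-trans (*-congˡ ([no]* (no ¬q) ¬q x)) (≈-trans (zeroʳ _) (≈-sym ([no]* (no ¬q) ¬q x)))

  sumOver-filter : ∀ {A : Set} {P : A → Set} (P? : ∀ x → Dec (P x)) (xs : List A) f →
                   sumOver (filter P? xs) f ≈ sumOver xs (λ a → [ P? a ] *ᴿ f a)
  sumOver-filter P? []       f = ≈-refl
  sumOver-filter P? (x ∷ xs) f with does (P? x)
  ... | true  = +-cong (≈-sym (*-identityˡ _)) (sumOver-filter P? xs f)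
  ... | false = ≈-trans (sumOver-filter P? xs f) (≈-sym (≈-trans (+-congʳ (zeroˡ _)) (+-identityˡ _)))

  -- Let φ be a bijection of
  -- the index list (expressed by invariance of sums under reindexing by φ)
  -- with g ∘ φ = - g.
  involution-cancels :
    ∀ {A : Set} (xs : List A) (φ : A → A) → (∀ f → sumOver xs (λ v → f (φ v)) ≈ sumOver xs f) →
    (g : A → Carrier) → (∀ v → g (φ v) ≈ - g v) →
    {Q : A → Set} (Q? : ∀ v → Dec (Q v)) → (∀ v → Q v → ¬ Q (φ v)) →
    (∀ v → ¬ Q v → ¬ Q (φ v) → g v ≈ 0#) → sumOver xs g ≈ 0#
  involution-cancels xs φ reindex g g∘φ Q? disjoint outside = begin
    sumOver xs g
      ≈⟨ sumOver-cong xs split ⟩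
    sumOver xs (λ v → [ Q? v ] *ᴿ g v +ᴿ [ Q? (φ v) ] *ᴿ g v)
      ≈⟨ sumOver-+ xs _ _ ⟩
    sumOver xs (λ v → [ Q? v ] *ᴿ g v) +ᴿ sumOver xs (λ v → [ Q? (φ v) ] *ᴿ g v)
      ≈⟨ +-congˡ (≈-trans (sumOver-cong xs (λ v → *-congˡ (≈-trans (≈-sym (-‿involutive (g v))) (-‿cong (≈-sym (g∘φ v))))))
                          (reindex (λ u → [ Q? u ] *ᴿ (- g u)))) ⟩
    sumOver xs (λ v → [ Q? v ] *ᴿ g v) +ᴿ sumOver xs (λ v → [ Q? v ] *ᴿ (- g v))
      ≈⟨ ≈-sym (sumOver-+ xs _ _) ⟩
    sumOver xs (λ v → [ Q? v ] *ᴿ g v +ᴿ [ Q? v ] *ᴿ (- g v))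
      ≈⟨ sumOver-zero xs _ (λ v → ≈-trans (≈-sym (distribˡ _ _ _)) (≈-trans (*-congˡ (-‿inverseʳ (g v))) (zeroʳ _))) ⟩
    0# ∎
    where
    split : ∀ v → g v ≈ [ Q? v ] *ᴿ g v +ᴿ [ Q? (φ v) ] *ᴿ g v
    split v with Q? v | Q? (φ v)
    ... | yes q | yes q′ = ⊥-elim (disjoint v q q′)
    ... | yes _ | no _   = ≈-sym (≈-trans (+-cong (*-identityˡ _) (zeroˡ _)) (+-identityʳ _))
    ... | no _  | yes _  = ≈-sym (≈-trans (+-cong (zeroˡ _) (*-identityˡ _)) (+-identityˡ _))
    ... | no ¬q | no ¬q′ = ≈-trans (outside v ¬q ¬q′) (≈-sym (≈-trans (+-cong (zeroˡ _) (zeroˡ _)) (+-identityˡ _)))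

  sumOver-allVecs : ∀ {A : Set} (L : List A) n (f : Vec A (suc n) → Carrier) →
                    sumOver (allVecs L (suc n)) f ≈ sumOver L (λ a → sumOver (allVecs L n) (λ v → f (a ∷ v)))
  sumOver-allVecs L n f = ≈-trans (sumOver-concatMap (λ a → map (a ∷_) (allVecs L n)) L f)
                                  (sumOver-cong L (λ a → reflexive (sumOver-map (a ∷_) (allVecs L n) f)))

  sumOver-allVecs-swapAt : ∀ {A : Set} (L : List A) n j (f : Vec A n → Carrier) →
                           sumOver (allVecs L n) (λ v → f (swapAt j v)) ≈ sumOver (allVecs L n) f
  sumOver-allVecs-swapAt L zero          zero    f = ≈-refl
  sumOver-allVecs-swapAt L zero          (suc j) f = ≈-refl
  sumOver-allVecs-swapAt L (suc zero)    zero    f = sumOver-cong (allVecs L 1) (λ { (a ∷ []) → ≈-refl })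
  sumOver-allVecs-swapAt L (suc (suc n)) zero    f = begin
    sumOver (allVecs L (suc (suc n))) (λ v → f (swapAt 0 v))
      ≈⟨ sumOver-allVecs L (suc n) _ ⟩
    sumOver L (λ a → sumOver (allVecs L (suc n)) (λ v → f (swapAt 0 (a ∷ v))))
      ≈⟨ sumOver-cong L (λ a → sumOver-allVecs L n _) ⟩
    sumOver L (λ a → sumOver L (λ b → sumOver (allVecs L n) (λ w → f (b ∷ a ∷ w))))
      ≈⟨ fubini L L _ ⟩
    sumOver L (λ b → sumOver L (λ a → sumOver (allVecs L n) (λ w → f (b ∷ a ∷ w))))
      ≈⟨ sumOver-cong L (λ b → ≈-sym (sumOver-allVecs L n _)) ⟩
    sumOver L (λ b → sumOver (allVecs L (suc n)) (λ v → f (b ∷ v)))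
      ≈⟨ ≈-sym (sumOver-allVecs L (suc n) _) ⟩
    sumOver (allVecs L (suc (suc n))) f ∎
  sumOver-allVecs-swapAt L (suc n)       (suc j) f =
    ≈-trans (sumOver-allVecs L n _)
      (≈-trans (sumOver-cong L (λ a → sumOver-allVecs-swapAt L n j (λ v → f (a ∷ v))))
               (≈-sym (sumOver-allVecs L n f)))

  sumOver-upTo-suc : ∀ N (g : ℕ → Carrier) → sumOver (upTo (suc N)) g ≈ g 0 +ᴿ sumOver (upTo N) (λ i → g (suc i))
  sumOver-upTo-suc N g = +-congˡ (reflexive (≡.trans (cong (λ l → sumL (map g l)) upTo-suc) (sumOver-map suc (upTo N) g)))
    where
    upTo-suc : applyUpTo suc N ≡ map suc (upTo N)
    upTo-suc = ≡.sym (ListP.map-upTo suc N)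

  sumOver-upTo-single : ∀ N b (g : ℕ → Carrier) → sumOver (upTo N) (λ a → [ a ≟ b ] *ᴿ g a) ≈ [ b <? N ] *ᴿ g b
  sumOver-upTo-single zero    b       g = ≈-sym ([no]* (b <? 0) (λ ()) (g b))
  sumOver-upTo-single (suc N) zero    g = begin
    sumOver (upTo (suc N)) (λ a → [ a ≟ 0 ] *ᴿ g a)
      ≈⟨ sumOver-upTo-suc N _ ⟩
    1# *ᴿ g 0 +ᴿ sumOver (upTo N) (λ a → [ suc a ≟ 0 ] *ᴿ g (suc a))
      ≈⟨ +-congˡ (sumOver-zero (upTo N) _ (λ a → [no]* (suc a ≟ 0) (λ ()) _)) ⟩
    1# *ᴿ g 0 +ᴿ 0#
      ≈⟨ ≈-trans (+-identityʳ _) (*-congʳ (reflexive (≡.sym ([yes] (0 <? suc N) (s≤s z≤n))))) ⟩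
    [ 0 <? suc N ] *ᴿ g 0 ∎
  sumOver-upTo-single (suc N) (suc b) g = begin
    sumOver (upTo (suc N)) (λ a → [ a ≟ suc b ] *ᴿ g a)
      ≈⟨ sumOver-upTo-suc N _ ⟩
    0# *ᴿ g 0 +ᴿ sumOver (upTo N) (λ a → [ suc a ≟ suc b ] *ᴿ g (suc a))
      ≈⟨ +-cong (zeroˡ _) (sumOver-cong (upTo N) (λ a →
           *-congʳ (reflexive ([⇔] (suc a ≟ suc b) (a ≟ b) ℕP.suc-injective (cong suc))))) ⟩
    0# +ᴿ sumOver (upTo N) (λ a → [ a ≟ b ] *ᴿ g (suc a))
      ≈⟨ +-identityˡ _ ⟩
    sumOver (upTo N) (λ a → [ a ≟ b ] *ᴿ g (suc a))
      ≈⟨ sumOver-upTo-single N b (λ i → g (suc i)) ⟩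
    [ b <? N ] *ᴿ g (suc b)
      ≈⟨ *-congʳ (reflexive ([⇔] (b <? N) (suc b <? suc N) s≤s s≤s⁻¹)) ⟩
    [ suc b <? suc N ] *ᴿ g (suc b) ∎

  sumOver-upTo-prefix : ∀ N T (g : ℕ → Carrier) → T < N →
                        sumOver (upTo N) (λ a → [ a ≤? T ] *ᴿ g a) ≈ sumOver (upTo (suc T)) g
  sumOver-upTo-prefix (suc N) zero    g _ = begin
    sumOver (upTo (suc N)) (λ a → [ a ≤? 0 ] *ᴿ g a)
      ≈⟨ sumOver-upTo-suc N _ ⟩
    1# *ᴿ g 0 +ᴿ sumOver (upTo N) (λ a → [ suc a ≤? 0 ] *ᴿ g (suc a))
      ≈⟨ +-cong (*-identityˡ _) (sumOver-zero (upTo N) _ (λ a → [no]* (suc a ≤? 0) (λ ()) _)) ⟩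
    g 0 +ᴿ 0# ∎
  sumOver-upTo-prefix (suc N) (suc T) g (s≤s T<N) = begin
    sumOver (upTo (suc N)) (λ a → [ a ≤? suc T ] *ᴿ g a)
      ≈⟨ sumOver-upTo-suc N _ ⟩
    1# *ᴿ g 0 +ᴿ sumOver (upTo N) (λ a → [ suc a ≤? suc T ] *ᴿ g (suc a))
      ≈⟨ +-cong (*-identityˡ _) (sumOver-cong (upTo N) (λ a →
           *-congʳ (reflexive ([⇔] (suc a ≤? suc T) (a ≤? T) s≤s⁻¹ s≤s)))) ⟩
    g 0 +ᴿ sumOver (upTo N) (λ a → [ a ≤? T ] *ᴿ g (suc a))
      ≈⟨ +-congˡ (sumOver-upTo-prefix N T (λ i → g (suc i)) T<N) ⟩
    g 0 +ᴿ sumOver (upTo (suc T)) (λ i → g (suc i))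
      ≈⟨ ≈-sym (sumOver-upTo-suc (suc T) g) ⟩
    sumOver (upTo (suc (suc T))) g ∎

  sumOver-upTo-interval : ∀ N m T (g : ℕ → Carrier) → m + T < N →
    sumOver (upTo N) (λ a → [ (m ≤? a) ×-dec (a ≤? m + T) ] *ᴿ g a) ≈ sumOver (upTo (suc T)) (λ e → g (m + e))
  sumOver-upTo-interval N zero T g T<N =
    ≈-trans (sumOver-cong (upTo N) (λ a → *-congʳ (reflexive ([⇔] ((0 ≤? a) ×-dec (a ≤? T)) (a ≤? T) proj₂ (z≤n ,_)))))
            (sumOver-upTo-prefix N T g T<N)
  sumOver-upTo-interval (suc N) (suc m) T g (s≤s m+T<N) = begin
    sumOver (upTo (suc N)) (λ a → [ (suc m ≤? a) ×-dec (a ≤? suc m + T) ] *ᴿ g a)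
      ≈⟨ sumOver-upTo-suc N _ ⟩
    [ (suc m ≤? 0) ×-dec (0 ≤? suc m + T) ] *ᴿ g 0
      +ᴿ sumOver (upTo N) (λ a → [ (suc m ≤? suc a) ×-dec (suc a ≤? suc m + T) ] *ᴿ g (suc a))
      ≈⟨ +-cong ([no]* ((suc m ≤? 0) ×-dec (0 ≤? suc m + T)) (λ { (() , _) }) _)
                (sumOver-cong (upTo N) (λ a → *-congʳ (reflexive
                  ([⇔] ((suc m ≤? suc a) ×-dec (suc a ≤? suc m + T)) ((m ≤? a) ×-dec (a ≤? m + T))
                       (λ { (s≤s p , s≤s q) → p , q }) (λ { (p , q) → s≤s p , s≤s q }))))) ⟩
    0# +ᴿ sumOver (upTo N) (λ a → [ (m ≤? a) ×-dec (a ≤? m + T) ] *ᴿ g (suc a))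
      ≈⟨ +-identityˡ _ ⟩
    sumOver (upTo N) (λ a → [ (m ≤? a) ×-dec (a ≤? m + T) ] *ᴿ g (suc a))
      ≈⟨ sumOver-upTo-interval N m T (λ i → g (suc i)) m+T<N ⟩
    sumOver (upTo (suc T)) (λ e → g (suc m + e)) ∎

  sumOver-allVecs-single : ∀ N n (v : Vec ℕ n) (G : Vec ℕ n → Carrier) →
    sumOver (allVecs (upTo N) n) (λ α → [ VecP.≡-dec _≟_ α v ] *ᴿ G α) ≈ [ bounded? N v ] *ᴿ G v
  sumOver-allVecs-single N zero    []      G = +-identityʳ _
  sumOver-allVecs-single N (suc n) (b ∷ v) G = begin
    sumOver (allVecs (upTo N) (suc n)) (λ α → [ VecP.≡-dec _≟_ α (b ∷ v) ] *ᴿ G α)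
      ≈⟨ sumOver-allVecs (upTo N) n _ ⟩
    sumOver (upTo N) (λ a → sumOver (allVecs (upTo N) n) (λ α → [ (a ≟ b) ×-dec VecP.≡-dec _≟_ α v ] *ᴿ G (a ∷ α)))
      ≈⟨ sumOver-cong (upTo N) (λ a → sumOver-cong (allVecs (upTo N) n) (λ α →
           ≈-trans (*-congʳ ([×] (a ≟ b) (VecP.≡-dec _≟_ α v))) (*-assoc _ _ _))) ⟩
    sumOver (upTo N) (λ a → sumOver (allVecs (upTo N) n) (λ α → [ a ≟ b ] *ᴿ ([ VecP.≡-dec _≟_ α v ] *ᴿ G (a ∷ α))))
      ≈⟨ sumOver-cong (upTo N) (λ a → ≈-trans (≈-sym (*-sumOver _ (allVecs (upTo N) n) _))
                                               (*-congˡ (sumOver-allVecs-single N n v (λ α → G (a ∷ α))))) ⟩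
    sumOver (upTo N) (λ a → [ a ≟ b ] *ᴿ ([ bounded? N v ] *ᴿ G (a ∷ v)))
      ≈⟨ sumOver-upTo-single N b _ ⟩
    [ b <? N ] *ᴿ ([ bounded? N v ] *ᴿ G (b ∷ v))
      ≈⟨ ≈-trans (≈-sym (*-assoc _ _ _)) (*-congʳ (≈-sym ([×] (b <? N) (bounded? N v)))) ⟩
    [ bounded? N (b ∷ v) ] *ᴿ G (b ∷ v) ∎

  sumOver-allVecs-point : ∀ N n (v : Vec ℕ n) (G : Vec ℕ n → Carrier) → (∀ k → lookup v k < N) →
    sumOver (allVecs (upTo N) n) (λ α → [ VecP.≡-dec _≟_ α v ] *ᴿ G α) ≈ G v
  sumOver-allVecs-point N n v G v<N =
    ≈-trans (sumOver-allVecs-single N n v G) ([yes]* (bounded? N v) (bounded N v v<N) (G v))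

  prodFin-cong : ∀ {m} {f g : Fin m → Carrier} → (∀ i → f i ≈ g i) → prodFin f ≈ prodFin g
  prodFin-cong {zero}  _   = ≈-refl
  prodFin-cong {suc m} f≈g = *-cong (f≈g fzero) (prodFin-cong (λ i → f≈g (fsuc i)))

  prodFin-transpose : ∀ {m} j (f : Fin m → Carrier) → prodFin f ≈ prodFin (λ i → f (transpose j i))
  prodFin-transpose {zero}        j       f = ≈-refl
  prodFin-transpose {suc zero}    zero    f = ≈-refl
  prodFin-transpose {suc (suc m)} zero    f = *ᴿ-left-comm (f fzero) (f (fsuc fzero)) _
  prodFin-transpose {suc m}       (suc j) f = *-congˡ (prodFin-transpose j (λ i → f (fsuc i)))

  prodFin-* : ∀ {m} (f g : Fin m → Carrier) → prodFin (λ i → f i *ᴿ g i) ≈ prodFin f *ᴿ prodFin g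
  prodFin-* {zero}  f g = ≈-sym (*-identityˡ 1#)
  prodFin-* {suc m} f g = ≈-trans (*-congˡ (prodFin-* (λ i → f (fsuc i)) (λ i → g (fsuc i)))) (*ᴿ-interchange _ _ _ _)

  prodFin-1 : ∀ {m} (f : Fin m → Carrier) → (∀ i → f i ≈ 1#) → prodFin f ≈ 1#
  prodFin-1 {zero}  f _    = ≈-refl
  prodFin-1 {suc m} f f≈1 = ≈-trans (*-cong (f≈1 fzero) (prodFin-1 (λ i → f (fsuc i)) (λ i → f≈1 (fsuc i)))) (*-identityˡ 1#)

  pow-+ : ∀ y a b → pow y (a + b) ≈ pow y a *ᴿ pow y b
  pow-+ y zero    b = ≈-sym (*-identityˡ _)
  pow-+ y (suc a) b = ≈-trans (*-congˡ (pow-+ y a b)) (≈-sym (*-assoc _ _ _))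

  pow-cong : ∀ {y y′} k → y ≈ y′ → pow y k ≈ pow y′ k
  pow-cong zero    _    = ≈-refl
  pow-cong (suc k) y≈y′ = *-cong y≈y′ (pow-cong k y≈y′)

  monoσ-swapAt : ∀ {n} (x : Fin n → Carrier) j (σ : Vec (Fin n) n) α → monoσ x σ (swapAt j α) ≈ monoσ x (swapAt j σ) α
  monoσ-swapAt x j σ α = ≈-trans
    (prodFin-cong (λ i → reflexive (cong₂ (λ u v → pow (x u) v)
        (≡.trans (cong (lookup σ) (≡.sym (transpose-involutive j i))) (≡.sym (lookup-swapAt j σ (transpose j i))))
        (lookup-swapAt j α i))))
    (≈-sym (prodFin-transpose j (λ i → pow (x (lookup (swapAt j σ) i)) (lookup α i))))

  monoσ-⊕ : ∀ {n} (x : Fin n → Carrier) (σ : Vec (Fin n) n) μ β → monoσ x σ (μ ⊕ β) ≈ monoσ x σ μ *ᴿ monoσ x σ β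
  monoσ-⊕ x σ μ β = ≈-trans
    (prodFin-cong (λ i → ≈-trans (reflexive (cong (pow (x (lookup σ i))) (VecP.lookup-zipWith _+_ i μ β)))
                                 (pow-+ (x (lookup σ i)) (lookup μ i) (lookup β i))))
    (prodFin-* (λ i → pow (x (lookup σ i)) (lookup μ i)) (λ i → pow (x (lookup σ i)) (lookup β i)))

  prodFin-pad : ∀ {c n} (p : c ≤ n) (z : Fin n → Carrier) (e : Vec ℕ c) →
                prodFin (λ i → pow (z i) (lookup (pad p e) i)) ≈ prodFin (λ i → pow (z (inject≤ i p)) (lookup e i))
  prodFin-pad z≤n     z []      = prodFin-1 _ (λ i → reflexive (cong (pow (z i)) (VecP.lookup-replicate i 0)))
  prodFin-pad (s≤s p) z (a ∷ e) = *-congˡ (prodFin-pad p (λ i → z (fsuc i)) e)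

  sgn-swapAt : ∀ {n} j (σ : Vec (Fin n) n) → IsPerm σ → suc j < n → sgn (swapAt j σ) ≈ - sgn σ
  sgn-swapAt j σ isPerm j+1<n with inversions-swapAt j σ isPerm j+1<n
  ... | inj₁ one-more = reflexive (cong negOnePow one-more)
  ... | inj₂ one-less = ≈-trans (≈-sym (-‿involutive _)) (-‿cong (reflexive (≡.sym (cong negOnePow one-less))))

  -- Weighted alternants a_W(α) = Σ_{σ ∈ S_n} sgn(σ) W(σ) x_σ^α.  With W = 1 this
  -- is `antisym`; W will be the product of the h-factors still to be expanded.

  alt : ∀ {n} (x : Fin n → Carrier) (W : Vec (Fin n) n → Carrier) → Vec ℕ n → Carrier
  alt {n} x W α = sumOver (Sn n) (λ σ → sgn σ *ᴿ (W σ *ᴿ monoσ x σ α))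

  -- The same sum, over all index vectors σ, with non-permutations weighted 0;
  -- on this index set the adjacent swaps act bijectively.
  altTerm : ∀ {n} (x : Fin n → Carrier) (W : Vec (Fin n) n → Carrier) → Vec ℕ n → Vec (Fin n) n → Carrier
  altTerm x W α σ = [ isPerm? σ ] *ᴿ (sgn σ *ᴿ (W σ *ᴿ monoσ x σ α))

  alt-allVecs : ∀ {n} (x : Fin n → Carrier) W α → alt x W α ≈ sumOver (allVecs (allFin n) n) (altTerm x W α)
  alt-allVecs {n} x W α = sumOver-filter isPerm? (allVecs (allFin n) n) _

  SwapInvariant : ∀ {n} → (Vec (Fin n) n → Carrier) → ℕ → Set r
  SwapInvariant W j = ∀ σ → W (swapAt j σ) ≈ W σ

  altTerm-swapAt : ∀ {n} (x : Fin n → Carrier) W j → suc j < n → SwapInvariant W j →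
                   ∀ α σ → altTerm x W α (swapAt j σ) ≈ - altTerm x W (swapAt j α) σ
  altTerm-swapAt x W j j+1<n W-inv α σ with isPerm? σ
  ... | yes isPerm = begin
      [ isPerm? (swapAt j σ) ] *ᴿ (sgn (swapAt j σ) *ᴿ (W (swapAt j σ) *ᴿ monoσ x (swapAt j σ) α))
        ≈⟨ *-cong (reflexive ([yes] (isPerm? (swapAt j σ)) (perm-swapAt j σ isPerm)))
                  (*-cong (sgn-swapAt j σ isPerm j+1<n) (*-cong (W-inv σ) (≈-sym (monoσ-swapAt x j σ α)))) ⟩
      1# *ᴿ (- sgn σ *ᴿ (W σ *ᴿ monoσ x σ (swapAt j α)))
        ≈⟨ ≈-trans (*-identityˡ _) (≈-sym (-‿distribˡ-* _ _)) ⟩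
      - (sgn σ *ᴿ (W σ *ᴿ monoσ x σ (swapAt j α)))
        ≈⟨ -‿cong (≈-sym ([yes]* (isPerm? σ) isPerm _)) ⟩
      - altTerm x W (swapAt j α) σ ∎
  ... | no ¬isPerm = ≈-trans ([no]* (isPerm? (swapAt j σ)) (λ q → ¬isPerm (perm-unswapAt j σ q)) _)
                             (≈-trans (≈-sym -0#≈0#) (-‿cong (≈-sym ([no]* (isPerm? σ) ¬isPerm _))))

  alt-swapAt : ∀ {n} (x : Fin n → Carrier) W j → suc j < n → SwapInvariant W j →
               ∀ α → alt x W (swapAt j α) ≈ - alt x W α
  alt-swapAt {n} x W j j+1<n W-inv α = begin
    alt x W (swapAt j α)
      ≈⟨ alt-allVecs x W (swapAt j α) ⟩
    sumOver Σn (altTerm x W (swapAt j α))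
      ≈⟨ sumOver-cong Σn (λ σ → ≈-trans (≈-sym (-‿involutive _)) (-‿cong (≈-sym (altTerm-swapAt x W j j+1<n W-inv α σ)))) ⟩
    sumOver Σn (λ σ → - altTerm x W α (swapAt j σ))
      ≈⟨ sumOver-neg Σn _ ⟩
    - sumOver Σn (λ σ → altTerm x W α (swapAt j σ))
      ≈⟨ -‿cong (sumOver-allVecs-swapAt (allFin n) n j (altTerm x W α)) ⟩
    - sumOver Σn (altTerm x W α)
      ≈⟨ -‿cong (≈-sym (alt-allVecs x W α)) ⟩
    - alt x W α ∎
    where Σn = allVecs (allFin n) n

  -- ... and therefore vanishes when two neighbouring exponents there coincide.
  -- (Pair σ with σ∘(j j+1), marking the σ with an ascent at j; this works in
  -- every characteristic, unlike "a = -a ⇒ a = 0".)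
  alt-repeated : ∀ {n} (x : Fin n → Carrier) W j → suc j < n → SwapInvariant W j →
                 ∀ α → at α j ≡ at α (suc j) → alt x W α ≈ 0#
  alt-repeated {n} x W j j+1<n W-inv α α-j≡α-j+1 = ≈-trans (alt-allVecs x W α)
    (involution-cancels (allVecs (allFin n) n) (swapAt j) (sumOver-allVecs-swapAt (allFin n) n j) (altTerm x W α)
      (λ σ → ≈-trans (altTerm-swapAt x W j j+1<n W-inv α σ) (-‿cong (reflexive (cong (λ β → altTerm x W β σ) (swapAt-equal j α α-j≡α-j+1)))))
      (λ σ → ascent? j (values σ))
      (λ σ asc asc′ → swapAt-ascent j (values σ) j+1<n asc (≡.subst (Ascent j) (map-swapAt toℕ j σ) asc′))
      non-permutation)
    where
    values : Vec (Fin n) n → Vec ℕ n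
    values = Vec.map toℕ
    non-permutation : ∀ σ → ¬ Ascent j (values σ) → ¬ Ascent j (values (swapAt j σ)) → altTerm x W α σ ≈ 0#
    non-permutation σ ¬asc ¬asc′ = [no]* (isPerm? σ) (λ isPerm →
      injective-at (values σ) (perm-injective σ isPerm) j j+1<n
        (no-ascent-either-way j (values σ) j+1<n ¬asc (λ asc′ → ¬asc′ (≡.subst (Ascent j) (≡.sym (map-swapAt toℕ j σ)) asc′)))) _

  -- h_T is a symmetric function: invariant under adjacent transpositions of
  -- its variables, because the exponent vectors of total degree T are.

  h-cong : ∀ m T {y y′ : Fin m → Carrier} → (∀ i → y i ≈ y′ i) → h m T y ≈ h m T y′
  h-cong m T y≈y′ = sumOver-cong (filter (λ e → sum e ≟ T) (compsUpTo m T))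
                                 (λ e → prodFin-cong (λ i → pow-cong (lookup e i) (y≈y′ i)))

  h-transpose : ∀ m T (y : Fin m → Carrier) j → h m T (λ i → y (transpose j i)) ≈ h m T y
  h-transpose m T y j = begin
    h m T (λ i → y (transpose j i))
      ≈⟨ sumOver-filter (λ e → sum e ≟ T) (compsUpTo m T) _ ⟩
    sumOver (compsUpTo m T) (λ e → [ sum e ≟ T ] *ᴿ prodFin (λ i → pow (y (transpose j i)) (lookup e i)))
      ≈⟨ ≈-sym (sumOver-allVecs-swapAt (upTo (suc T)) m j _) ⟩
    sumOver (compsUpTo m T) (λ e → [ sum (swapAt j e) ≟ T ] *ᴿ prodFin (λ i → pow (y (transpose j i)) (lookup (swapAt j e) i)))
      ≈⟨ sumOver-cong (compsUpTo m T) (λ e → *-cong (reflexive (cong (λ s → [ s ≟ T ]) (sum-swapAt j e)))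
           (≈-trans (prodFin-cong (λ i → reflexive (cong (pow (y (transpose j i))) (lookup-swapAt j e i))))
                    (≈-sym (prodFin-transpose j (λ i → pow (y i) (lookup e i)))))) ⟩
    sumOver (compsUpTo m T) (λ e → [ sum e ≟ T ] *ᴿ prodFin (λ i → pow (y i) (lookup e i)))
      ≈⟨ ≈-sym (sumOver-filter (λ e → sum e ≟ T) (compsUpTo m T) _) ⟩
    h m T y ∎

  hσ-swapAt : ∀ {n} (x : Fin n → Carrier) m T (m≤n : m ≤ n) j → suc j < m →
              SwapInvariant (λ σ → h m T (λ i → x (lookup σ (inject≤ i m≤n)))) j
  hσ-swapAt x m T m≤n j j+1<m σ = ≈-trans
    (h-cong m T (λ i → reflexive (cong x (≡.trans (lookup-swapAt j σ (inject≤ i m≤n))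
                                                   (cong (lookup σ) (transpose-inject≤ j i m≤n j+1<m))))))
    (h-transpose m T (λ i → x (lookup σ (inject≤ i m≤n))) j)

  prodFin-swapInvariant : ∀ {n ℓ} (W : Fin ℓ → Vec (Fin n) n → Carrier) j →
                          (∀ h → SwapInvariant (W h) j) → SwapInvariant (λ σ → prodFin (λ h → W h σ)) j
  prodFin-swapInvariant W j W-inv σ = prodFin-cong (λ h → W-inv h σ)

  -- Re-indexing the exponents e ∈ [0,T]^c of a monomial of h_T(x_{σ₁},…,x_{σ_c})
  -- by α = μ ⊕ pad e, inside the bigger cube [0,B]^n (which contains the box
  -- as soon as μ_k + T ≤ B).
  sumOver-box : ∀ {c n} (p : c ≤ n) T B (μ : Vec ℕ n) (F : Vec ℕ n → Carrier) → (∀ k → lookup μ k + T ≤ B) →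
    sumOver (allVecs (upTo (suc T)) c) (λ e → F (μ ⊕ pad p e))
      ≈ sumOver (allVecs (upTo (suc B)) n) (λ α → [ inBox? p T μ α ] *ᴿ F α)
  sumOver-box {n = n} z≤n T B μ F μ+T≤B = begin
    F (μ ⊕ replicate n 0) +ᴿ 0#
      ≈⟨ ≈-trans (+-identityʳ _) (reflexive (cong F (⊕-zeros μ))) ⟩
    F μ
      ≈⟨ ≈-sym (sumOver-allVecs-point (suc B) n μ F (λ k → s≤s (ℕP.≤-trans (ℕP.m≤m+n (lookup μ k) T) (μ+T≤B k)))) ⟩
    sumOver (allVecs (upTo (suc B)) n) (λ α → [ VecP.≡-dec _≟_ α μ ] *ᴿ F α) ∎
  sumOver-box {suc c} {suc n} (s≤s p) T B (m ∷ μ) F μ+T≤B = begin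
    sumOver (allVecs (upTo (suc T)) (suc c)) (λ e → F ((m ∷ μ) ⊕ pad (s≤s p) e))
      ≈⟨ sumOver-allVecs (upTo (suc T)) c _ ⟩
    sumOver (upTo (suc T)) (λ e₀ → sumOver (allVecs (upTo (suc T)) c) (λ e → F ((m + e₀) ∷ (μ ⊕ pad p e))))
      ≈⟨ sumOver-cong (upTo (suc T)) (λ e₀ → sumOver-box p T B μ (λ α → F ((m + e₀) ∷ α)) (λ k → μ+T≤B (fsuc k))) ⟩
    sumOver (upTo (suc T)) (λ e₀ → G (m + e₀))
      ≈⟨ ≈-sym (sumOver-upTo-interval (suc B) m T G (s≤s (μ+T≤B fzero))) ⟩
    sumOver (upTo (suc B)) (λ a → [ (m ≤? a) ×-dec (a ≤? m + T) ] *ᴿ G a)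
      ≈⟨ sumOver-cong (upTo (suc B)) (λ a → ≈-trans (*-sumOver _ Ln _)
           (sumOver-cong Ln (λ α → ≈-trans (≈-sym (*-assoc _ _ _))
              (*-congʳ (≈-sym ([×] ((m ≤? a) ×-dec (a ≤? m + T)) (inBox? p T μ α))))))) ⟩
    sumOver (upTo (suc B)) (λ a → sumOver Ln (λ α → [ inBox? (s≤s p) T (m ∷ μ) (a ∷ α) ] *ᴿ F (a ∷ α)))
      ≈⟨ ≈-sym (sumOver-allVecs (upTo (suc B)) n _) ⟩
    sumOver (allVecs (upTo (suc B)) (suc n)) (λ α → [ inBox? (s≤s p) T (m ∷ μ) α ] *ᴿ F α) ∎
    where
    Ln = allVecs (upTo (suc B)) n
    G : ℕ → Carrier
    G a = sumOver Ln (λ α → [ inBox? p T μ α ] *ᴿ F (a ∷ α))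

  -- Data: a strict μ, the first step (c ≤ n, T), a cube [0,B]^n large enough
  -- to contain all step extensions, and a weight W that is symmetric in the
  -- first c positions (the remaining h-factors, whose c's are ≥ c).
  module FirstStep {n} (x : Fin n → Carrier) (μ : Vec ℕ n) (strict : Strict μ) (c : ℕ) (c≤n : c ≤ n)
                   (T B : ℕ) (μ+T≤B : ∀ k → lookup μ k + T ≤ B)
                   (W : Vec (Fin n) n → Carrier) (W-inv : ∀ j → suc j < c → SwapInvariant W j) where

    Ln : List (Vec ℕ n)
    Ln = allVecs (upTo (suc B)) n

    hσ : Vec (Fin n) n → Carrier
    hσ σ = h c T (λ i → x (lookup σ (inject≤ i c≤n)))

    -- Expanding h_T(x_{σ₁},…,x_{σ_c}) into monomials x_σ^{pad e} and
    -- collecting terms by the new exponent α = μ ⊕ pad e gives a sum over all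
    -- step extensions α of μ.
    expand-h : sumOver (Sn n) (λ σ → sgn σ *ᴿ ((hσ σ *ᴿ W σ) *ᴿ monoσ x σ μ))
                 ≈ sumOver Ln (λ α → [ isStep? c T μ α ] *ᴿ alt x W α)
    expand-h = begin
      sumOver (Sn n) (λ σ → sgn σ *ᴿ ((hσ σ *ᴿ W σ) *ᴿ monoσ x σ μ))
        ≈⟨ sumOver-cong (Sn n) expand-term ⟩
      sumOver (Sn n) (λ σ → sumOver E (λ e → sgn σ *ᴿ (W σ *ᴿ monoσ x σ (μ ⊕ pad c≤n e))))
        ≈⟨ fubini (Sn n) E _ ⟩
      sumOver E (λ e → alt x W (μ ⊕ pad c≤n e))
        ≈⟨ sumOver-filter (λ e → sum e ≟ T) Lc _ ⟩
      sumOver Lc (λ e → [ sum e ≟ T ] *ᴿ alt x W (μ ⊕ pad c≤n e))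
        ≈⟨ sumOver-cong Lc (λ e → *-congʳ (reflexive ([⇔] (sum e ≟ T) (sum (μ ⊕ pad c≤n e) ≟ sum μ + T)
             (λ |e| → ≡.trans (sum-⊕ μ (pad c≤n e)) (cong (sum μ +_) (≡.trans (sum-pad c≤n e) |e|)))
             (λ |α| → ≡.trans (≡.sym (sum-pad c≤n e)) (ℕP.+-cancelˡ-≡ (sum μ) _ _ (≡.trans (≡.sym (sum-⊕ μ (pad c≤n e))) |α|)))))) ⟩
      sumOver Lc (λ e → F (μ ⊕ pad c≤n e))
        ≈⟨ sumOver-box c≤n T B μ F μ+T≤B ⟩
      sumOver Ln (λ α → [ inBox? c≤n T μ α ] *ᴿ F α)
        ≈⟨ sumOver-cong Ln (λ α → ≈-trans (≈-sym (*-assoc _ _ _)) (*-congʳ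
             (≈-trans (≈-sym ([×] (inBox? c≤n T μ α) (sum α ≟ sum μ + T)))
                      (reflexive ([⇔] (inBox? c≤n T μ α ×-dec (sum α ≟ sum μ + T)) (isStep? c T μ α)
                                      (proj₁ (step⇔InBox c≤n T μ α)) (proj₂ (step⇔InBox c≤n T μ α))))))) ⟩
      sumOver Ln (λ α → [ isStep? c T μ α ] *ᴿ alt x W α) ∎
      where
      Lc = allVecs (upTo (suc T)) c
      E = filter (λ e → sum e ≟ T) (compsUpTo c T)
      F : Vec ℕ n → Carrier
      F α = [ sum α ≟ sum μ + T ] *ᴿ alt x W α
      xσ^ : Vec ℕ c → Vec (Fin n) n → Carrier
      xσ^ e σ = prodFin (λ i → pow (x (lookup σ (inject≤ i c≤n))) (lookup e i))
      expand-term : ∀ σ → sgn σ *ᴿ ((hσ σ *ᴿ W σ) *ᴿ monoσ x σ μ)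
                          ≈ sumOver E (λ e → sgn σ *ᴿ (W σ *ᴿ monoσ x σ (μ ⊕ pad c≤n e)))
      expand-term σ = begin
        sgn σ *ᴿ ((sumOver E (λ e → xσ^ e σ) *ᴿ W σ) *ᴿ monoσ x σ μ)
          ≈⟨ *-congˡ (≈-trans (*-congʳ (sumOver-* (W σ) E _)) (sumOver-* (monoσ x σ μ) E _)) ⟩
        sgn σ *ᴿ sumOver E (λ e → (xσ^ e σ *ᴿ W σ) *ᴿ monoσ x σ μ)
          ≈⟨ *-sumOver (sgn σ) E _ ⟩
        sumOver E (λ e → sgn σ *ᴿ ((xσ^ e σ *ᴿ W σ) *ᴿ monoσ x σ μ))
          ≈⟨ sumOver-cong E (λ e → *-congˡ (begin
               (xσ^ e σ *ᴿ W σ) *ᴿ monoσ x σ μ      ≈⟨ ≈-trans (*-congʳ (*-comm _ _)) (*-assoc _ _ _) ⟩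
               W σ *ᴿ (xσ^ e σ *ᴿ monoσ x σ μ)      ≈⟨ *-congˡ (*-comm _ _) ⟩
               W σ *ᴿ (monoσ x σ μ *ᴿ xσ^ e σ)      ≈⟨ *-congˡ (*-congˡ (≈-sym (prodFin-pad c≤n (λ i → x (lookup σ i)) e))) ⟩
               W σ *ᴿ (monoσ x σ μ *ᴿ monoσ x σ (pad c≤n e)) ≈⟨ *-congˡ (≈-sym (monoσ-⊕ x σ μ (pad c≤n e))) ⟩
               W σ *ᴿ monoσ x σ (μ ⊕ pad c≤n e)     ∎)) ⟩
        sumOver E (λ e → sgn σ *ᴿ (W σ *ᴿ monoσ x σ (μ ⊕ pad c≤n e))) ∎

    -- The step extensions failing goodness first at position d contribute 0:
    -- the swap of positions d, d+1 maps them to themselves, reverses the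
    -- sign of a_W, and can only fix α when α_d = α_{d+1}, where a_W = 0.
    firstFailure-cancels : ∀ d → sumOver Ln (λ α → [ failsFirstAt? c T μ d α ] *ᴿ alt x W α) ≈ 0#
    firstFailure-cancels d with suc d <? c
    ... | no d+1≮c = sumOver-zero Ln _ (λ α → [no]* (failsFirstAt? c T μ d α)
                                                      (λ (_ , bad) → bad (GoodAt-vacuous c μ d α d+1≮c)) _)
    ... | yes d+1<c = involution-cancels Ln (swapAt d) (sumOver-allVecs-swapAt (upTo (suc B)) n d) g g∘swap
                        (ascent? d) (λ α → swapAt-ascent d α d+1<n) no-ascent
      where
      d+1<n : suc d < n
      d+1<n = ℕP.<-≤-trans d+1<c c≤n
      g : Vec ℕ n → Carrier
      g α = [ failsFirstAt? c T μ d α ] *ᴿ alt x W α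
      preserved : ∀ α → FailsFirstAt c T μ d α → FailsFirstAt c T μ d (swapAt d α)
      preserved α = swapAt-FailsFirstAt c T μ d α c≤n strict d+1<c
      g∘swap : ∀ α → g (swapAt d α) ≈ - g α
      g∘swap α = ≈-trans
        (*-cong (reflexive ([⇔] (failsFirstAt? c T μ d (swapAt d α)) (failsFirstAt? c T μ d α)
                               (λ q → ≡.subst (FailsFirstAt c T μ d) (swapAt-involutive d α) (preserved (swapAt d α) q))
                               (preserved α)))
                (alt-swapAt x W d d+1<n (W-inv d d+1<c) α))
        (≈-sym (-‿distribʳ-* _ _))
      no-ascent : ∀ α → ¬ Ascent d α → ¬ Ascent d (swapAt d α) → g α ≈ 0#
      no-ascent α ¬asc ¬asc′ = ≈-trans
        (*-congˡ (alt-repeated x W d d+1<n (W-inv d d+1<c) α (no-ascent-either-way d α d+1<n ¬asc ¬asc′)))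
        (zeroʳ _)

    -- Imposing goodness at position d (given goodness after d) does not
    -- change the sum: the dropped terms are exactly those failing first at d.
    impose-goodAt : ∀ d → sumOver Ln (λ α → [ isStep? c T μ α ×-dec goodFrom? c μ (suc d) α ] *ᴿ alt x W α)
                            ≈ sumOver Ln (λ α → [ isStep? c T μ α ×-dec goodFrom? c μ d α ] *ᴿ alt x W α)
    impose-goodAt d = begin
      sumOver Ln (λ α → [ E? α ×-dec goodFrom? c μ (suc d) α ] *ᴿ alt x W α)
        ≈⟨ sumOver-cong Ln (λ α → ≈-trans (*-congʳ ([split] (E? α ×-dec goodFrom? c μ (suc d) α) (goodAt? c μ d α)))
                                          (distribʳ _ _ _)) ⟩
      sumOver Ln (λ α → [ (E? α ×-dec goodFrom? c μ (suc d) α) ×-dec goodAt? c μ d α ] *ᴿ alt x W α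
                        +ᴿ [ failsFirstAt? c T μ d α ] *ᴿ alt x W α)
        ≈⟨ sumOver-+ Ln _ _ ⟩
      sumOver Ln (λ α → [ (E? α ×-dec goodFrom? c μ (suc d) α) ×-dec goodAt? c μ d α ] *ᴿ alt x W α)
        +ᴿ sumOver Ln (λ α → [ failsFirstAt? c T μ d α ] *ᴿ alt x W α)
        ≈⟨ +-cong (sumOver-cong Ln (λ α → *-congʳ (reflexive
                    ([⇔] ((E? α ×-dec goodFrom? c μ (suc d) α) ×-dec goodAt? c μ d α) (E? α ×-dec goodFrom? c μ d α)
                         (λ ((step , good) , goodAt) → step , proj₂ (GoodFrom-split c μ d α) (good , goodAt))
                         (λ (step , good) → (step , proj₁ (proj₁ (GoodFrom-split c μ d α) good))
                                            , proj₂ (proj₁ (GoodFrom-split c μ d α) good))))))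
                  (firstFailure-cancels d) ⟩
      sumOver Ln (λ α → [ E? α ×-dec goodFrom? c μ d α ] *ᴿ alt x W α) +ᴿ 0#
        ≈⟨ +-identityʳ _ ⟩
      sumOver Ln (λ α → [ E? α ×-dec goodFrom? c μ d α ] *ᴿ alt x W α) ∎
      where E? = isStep? c T μ

    impose-goodFrom : ∀ d → sumOver Ln (λ α → [ isStep? c T μ α ×-dec goodFrom? c μ d α ] *ᴿ alt x W α)
                              ≈ sumOver Ln (λ α → [ isStep? c T μ α ×-dec goodFrom? c μ 0 α ] *ᴿ alt x W α)
    impose-goodFrom zero    = ≈-refl
    impose-goodFrom (suc d) = ≈-trans (impose-goodAt d) (impose-goodFrom d)

    keep-good-steps : sumOver Ln (λ α → [ isStep? c T μ α ] *ᴿ alt x W α)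
                        ≈ sumOver Ln (λ α → [ isStep? c T μ α ×-dec isGoodStep? c μ α ] *ᴿ alt x W α)
    keep-good-steps = begin
      sumOver Ln (λ α → [ isStep? c T μ α ] *ᴿ alt x W α)
        ≈⟨ sumOver-cong Ln (λ α → *-congʳ (reflexive ([⇔] (isStep? c T μ α) (isStep? c T μ α ×-dec goodFrom? c μ c α)
                                                           (_, GoodFrom-vacuous c μ α) proj₁))) ⟩
      sumOver Ln (λ α → [ isStep? c T μ α ×-dec goodFrom? c μ c α ] *ᴿ alt x W α)
        ≈⟨ impose-goodFrom c ⟩
      sumOver Ln (λ α → [ isStep? c T μ α ×-dec goodFrom? c μ 0 α ] *ᴿ alt x W α)
        ≈⟨ sumOver-cong Ln (λ α → *-congʳ (reflexive ([⇔] (isStep? c T μ α ×-dec goodFrom? c μ 0 α)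
                                                           (isStep? c T μ α ×-dec isGoodStep? c μ α)
             (λ (step , good) → step , proj₁ (GoodFrom-zero⇔ c μ α) good)
             (λ (step , good) → step , proj₂ (GoodFrom-zero⇔ c μ α) good)))) ⟩
      sumOver Ln (λ α → [ isStep? c T μ α ×-dec isGoodStep? c μ α ] *ᴿ alt x W α) ∎

    one-step : sumOver (Sn n) (λ σ → sgn σ *ᴿ ((hσ σ *ᴿ W σ) *ᴿ monoσ x σ μ))
                 ≈ sumOver Ln (λ α → [ isStep? c T μ α ×-dec isGoodStep? c μ α ] *ᴿ alt x W α)
    one-step = ≈-trans expand-h keep-good-steps

  module _ {n ℓ : ℕ} (c T : Fin (suc ℓ) → ℕ) (μ : Vec ℕ n) where

    private
      c′ T′ : Fin ℓ → ℕ
      c′ h = c (fsuc h)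
      T′ h = T (fsuc h)
      B = sum μ + sumFin c T μ T
      L = compsUpTo n B

    firstStep? : ∀ α → Dec (IsStep (c fzero) (T fzero) μ α × IsGoodStep (c fzero) μ α)
    firstStep? α = isStep? (c fzero) (T fzero) μ α ×-dec isGoodStep? (c fzero) μ α

    sumOver-goodTExtensions : (G : Vec (Vec ℕ n) (suc (suc ℓ)) → Carrier) →
      sumOver (goodTExtensions c T μ) G
        ≈ sumOver (allVecs L (suc ℓ)) (λ Λ → [ firstStep? (lookup Λ fzero) ]
                                            *ᴿ ([ isGoodTExtension? c′ T′ (lookup Λ fzero) Λ ] *ᴿ G (μ ∷ Λ)))
    sumOver-goodTExtensions G = begin
      sumOver (goodTExtensions c T μ) G
        ≈⟨ sumOver-filter (isGoodTExtension? c T μ) (allVecs L (suc (suc ℓ))) G ⟩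
      sumOver (allVecs L (suc (suc ℓ))) (λ Λ → [ isGoodTExtension? c T μ Λ ] *ᴿ G Λ)
        ≈⟨ sumOver-allVecs L (suc ℓ) _ ⟩
      sumOver L (λ a → sumOver (allVecs L (suc ℓ)) (λ Λ → [ isGoodTExtension? c T μ (a ∷ Λ) ] *ᴿ G (a ∷ Λ)))
        ≈⟨ sumOver-cong L (λ a → ≈-trans (sumOver-cong (allVecs L (suc ℓ)) (split a)) (≈-sym (*-sumOver _ (allVecs L (suc ℓ)) _))) ⟩
      sumOver L (λ a → [ VecP.≡-dec _≟_ a μ ] *ᴿ Rest a)
        ≈⟨ sumOver-allVecs-point (suc B) n μ Rest (λ k → s≤s (ℕP.≤-trans (lookup≤sum μ k) (ℕP.m≤m+n _ _))) ⟩
      Rest μ ∎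
      where
      Rest : Vec ℕ n → Carrier
      Rest a = sumOver (allVecs L (suc ℓ)) (λ Λ → [ firstStep? (lookup Λ fzero) ]
                                                  *ᴿ ([ isGoodTExtension? c′ T′ (lookup Λ fzero) Λ ] *ᴿ G (a ∷ Λ)))
      split : ∀ a Λ → [ isGoodTExtension? c T μ (a ∷ Λ) ] *ᴿ G (a ∷ Λ)
                      ≈ [ VecP.≡-dec _≟_ a μ ] *ᴿ ([ firstStep? (lookup Λ fzero) ]
                          *ᴿ ([ isGoodTExtension? c′ T′ (lookup Λ fzero) Λ ] *ᴿ G (a ∷ Λ)))
      split a Λ = ≈-trans
        (*-congʳ (≈-trans (reflexive ([⇔] (isGoodTExtension? c T μ (a ∷ Λ))
                                          (VecP.≡-dec _≟_ a μ ×-dec (firstStep? λ¹ ×-dec isGoodTExtension? c′ T′ λ¹ Λ))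
                                          (goodTExtension⇒firstStep c T μ a Λ) (firstStep⇒goodTExtension c T μ a Λ)))
                          (≈-trans ([×] (VecP.≡-dec _≟_ a μ) (firstStep? λ¹ ×-dec isGoodTExtension? c′ T′ λ¹ Λ))
                                   (*-congˡ ([×] (firstStep? λ¹) (isGoodTExtension? c′ T′ λ¹ Λ))))))
        (≈-trans (*-assoc _ _ _) (*-congˡ (*-assoc _ _ _)))
        where λ¹ = lookup Λ fzero

    -- The rest of a good extension starts at a first step α, and all
    -- extensions of such α live in the same finite candidate set.
    sumOver-first-steps : (F : Vec (Vec ℕ n) (suc ℓ) → Carrier) →
      sumOver L (λ α → [ firstStep? α ] *ᴿ sumOver (goodTExtensions c′ T′ α) F)
        ≈ sumOver (allVecs L (suc ℓ)) (λ Λ → [ firstStep? (lookup Λ fzero) ]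
                                            *ᴿ ([ isGoodTExtension? c′ T′ (lookup Λ fzero) Λ ] *ᴿ F Λ))
    sumOver-first-steps F = begin
      sumOver L (λ α → [ firstStep? α ] *ᴿ sumOver (goodTExtensions c′ T′ α) F)
        ≈⟨ sumOver-cong L (λ α → [guard] (firstStep? α) (λ (step , _) → reflexive (cong (λ Λs → sumOver Λs F) (candidates-agree α step)))) ⟩
      sumOver L (λ α → [ firstStep? α ] *ᴿ sumOver (filter (isGoodTExtension? c′ T′ α) (allVecs L (suc ℓ))) F)
        ≈⟨ sumOver-cong L (λ α → ≈-trans (*-congˡ (sumOver-filter (isGoodTExtension? c′ T′ α) (allVecs L (suc ℓ)) F))
                                         (*-sumOver _ (allVecs L (suc ℓ)) _)) ⟩
      sumOver L (λ α → sumOver (allVecs L (suc ℓ)) (λ Λ → [ firstStep? α ] *ᴿ ([ isGoodTExtension? c′ T′ α Λ ] *ᴿ F Λ)))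
        ≈⟨ fubini L (allVecs L (suc ℓ)) _ ⟩
      sumOver (allVecs L (suc ℓ)) (λ Λ → sumOver L (λ α → [ firstStep? α ] *ᴿ ([ isGoodTExtension? c′ T′ α Λ ] *ᴿ F Λ)))
        ≈⟨ sumOver-cong (allVecs L (suc ℓ)) collapse ⟩
      sumOver (allVecs L (suc ℓ)) (λ Λ → [ firstStep? (lookup Λ fzero) ]
                                        *ᴿ ([ isGoodTExtension? c′ T′ (lookup Λ fzero) Λ ] *ᴿ F Λ)) ∎
      where
      -- the candidate bound |α| + Σ_{h ≥ 2} T_h of the rest equals B
      candidates-agree : ∀ α → IsStep (c fzero) (T fzero) μ α →
                         goodTExtensions c′ T′ α ≡ filter (isGoodTExtension? c′ T′ α) (allVecs L (suc ℓ))
      candidates-agree α (_ , |α| , _) = cong (λ b → filter (isGoodTExtension? c′ T′ α) (allVecs (compsUpTo n b) (suc ℓ)))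
        (≡.trans (cong₂ _+_ |α| (sumFin-irrelevant c′ T′ α c T μ T′)) (ℕP.+-assoc (sum μ) (T fzero) _))
      in-cube : ∀ β → IsStep (c fzero) (T fzero) μ β × IsGoodStep (c fzero) μ β → Bounded (suc B) β
      in-cube β ((β⊇μ , |β| , _) , _) = bounded (suc B) β (λ k → s≤s (ℕP.≤-trans (part-bound μ β (T fzero) β⊇μ |β| k)
                                          (ℕP.+-mono-≤ (lookup≤sum μ k) (ℕP.m≤m+n (T fzero) _))))
      -- only α = λ¹ contributes
      collapse : ∀ Λ → sumOver L (λ α → [ firstStep? α ] *ᴿ ([ isGoodTExtension? c′ T′ α Λ ] *ᴿ F Λ))
                       ≈ [ firstStep? (lookup Λ fzero) ] *ᴿ ([ isGoodTExtension? c′ T′ (lookup Λ fzero) Λ ] *ᴿ F Λ)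
      collapse Λ = begin
        sumOver L (λ α → [ firstStep? α ] *ᴿ ([ isGoodTExtension? c′ T′ α Λ ] *ᴿ F Λ))
          ≈⟨ sumOver-cong L (λ α → ≈-trans (*-congˡ (*-congʳ (≈-trans
                 (reflexive ([⇔] (isGoodTExtension? c′ T′ α Λ) (VecP.≡-dec _≟_ α λ¹ ×-dec isGoodTExtension? c′ T′ λ¹ Λ)
                                 (goodTExtension⇒head c′ T′ α Λ) (head⇒goodTExtension c′ T′ α Λ)))
                 ([×] (VecP.≡-dec _≟_ α λ¹) (isGoodTExtension? c′ T′ λ¹ Λ)))))
               (≈-trans (*-congˡ (*-assoc _ _ _)) (*ᴿ-left-comm _ _ _))) ⟩
        sumOver L (λ α → [ VecP.≡-dec _≟_ α λ¹ ] *ᴿ ([ firstStep? α ] *ᴿ ([ isGoodTExtension? c′ T′ λ¹ Λ ] *ᴿ F Λ)))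
          ≈⟨ sumOver-allVecs-single (suc B) n λ¹ _ ⟩
        [ bounded? (suc B) λ¹ ] *ᴿ ([ firstStep? λ¹ ] *ᴿ ([ isGoodTExtension? c′ T′ λ¹ Λ ] *ᴿ F Λ))
          ≈⟨ [absorb] (bounded? (suc B) λ¹) (firstStep? λ¹) _ (in-cube λ¹) ⟩
        [ firstStep? λ¹ ] *ᴿ ([ isGoodTExtension? c′ T′ λ¹ Λ ] *ᴿ F Λ) ∎
        where λ¹ = lookup Λ fzero

  sumOver-goodTExtensions-zero : ∀ {n} (c T : Fin 0 → ℕ) (μ : Vec ℕ n) (G : Vec (Vec ℕ n) 1 → Carrier) →
                                 sumOver (goodTExtensions c T μ) G ≈ G (μ ∷ [])
  sumOver-goodTExtensions-zero {n} c T μ G = begin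
    sumOver (goodTExtensions c T μ) G
      ≈⟨ sumOver-filter (isGoodTExtension? c T μ) (allVecs L 1) G ⟩
    sumOver (allVecs L 1) (λ Λ → [ isGoodTExtension? c T μ Λ ] *ᴿ G Λ)
      ≈⟨ sumOver-allVecs L 0 _ ⟩
    sumOver L (λ a → [ isGoodTExtension? c T μ (a ∷ []) ] *ᴿ G (a ∷ []) +ᴿ 0#)
      ≈⟨ sumOver-cong L (λ a → ≈-trans (+-identityʳ _) (*-congʳ (reflexive
           ([⇔] (isGoodTExtension? c T μ (a ∷ [])) (VecP.≡-dec _≟_ a μ) (λ ((a≡μ , _) , _) → a≡μ) (λ a≡μ → (a≡μ , λ ()) , λ ()))))) ⟩
    sumOver L (λ a → [ VecP.≡-dec _≟_ a μ ] *ᴿ G (a ∷ []))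
      ≈⟨ sumOver-allVecs-point (suc (sum μ + 0)) n μ (λ a → G (a ∷ []))
                               (λ k → s≤s (ℕP.≤-trans (lookup≤sum μ k) (ℕP.m≤m+n (sum μ) 0))) ⟩
    G (μ ∷ []) ∎
    where L = compsUpTo n (sum μ + 0)

  hWeight : ∀ {n ℓ} (x : Fin n → Carrier) (c : Fin ℓ → ℕ) → (∀ h → c h ≤ n) → (T : Fin ℓ → ℕ) → Vec (Fin n) n → Carrier
  hWeight x c c≤n T σ = prodFin (λ h → RingDefs.h R (c h) (T h) (λ i → x (lookup σ (inject≤ i (c≤n h)))))

  expansion : ∀ (n ℓ : ℕ) (μ : Vec ℕ n) → Strict μ →
              (c : Fin ℓ → ℕ) (c≤n : ∀ h → c h ≤ n) → (∀ (h h′ : Fin ℓ) → toℕ h ≤ toℕ h′ → c h ≤ c h′) →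
              (T : Fin ℓ → ℕ) (x : Fin n → Carrier) →
              sumOver (Sn n) (λ σ → sgn σ *ᴿ (hWeight x c c≤n T σ *ᴿ monoσ x σ μ))
                ≈ sumOver (goodTExtensions c T μ) (λ Λ → antisym x (lookup Λ (fromℕ ℓ)))
  expansion n zero μ strict c c≤n c-mono T x = begin
    sumOver (Sn n) (λ σ → sgn σ *ᴿ (1# *ᴿ monoσ x σ μ))
      ≈⟨ sumOver-cong (Sn n) (λ σ → *-congˡ (*-identityˡ _)) ⟩
    antisym x μ
      ≈⟨ ≈-sym (sumOver-goodTExtensions-zero c T μ (λ Λ → antisym x (lookup Λ fzero))) ⟩
    sumOver (goodTExtensions c T μ) (λ Λ → antisym x (lookup Λ fzero)) ∎
  expansion n (suc ℓ) μ strict c c≤n c-mono T x = begin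
    sumOver (Sn n) (λ σ → sgn σ *ᴿ ((hσ σ *ᴿ W σ) *ᴿ monoσ x σ μ))
      ≈⟨ FirstStep.one-step x μ strict (c fzero) (c≤n fzero) (T fzero) B μ+T≤B W W-inv ⟩
    sumOver L (λ α → [ firstStep? c T μ α ] *ᴿ alt x W α)
      ≈⟨ sumOver-cong L (λ α → [guard] (firstStep? c T μ α) (λ (step , good) →
           expansion n ℓ α (strict-step (c fzero) (T fzero) μ α (c≤n fzero) strict step good)
                     c′ (λ h → c≤n (fsuc h)) (λ h h′ h≤h′ → c-mono (fsuc h) (fsuc h′) (s≤s h≤h′)) T′ x)) ⟩
    sumOver L (λ α → [ firstStep? c T μ α ] *ᴿ sumOver (goodTExtensions c′ T′ α) F)
      ≈⟨ sumOver-first-steps c T μ F ⟩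
    sumOver (allVecs L (suc ℓ)) (λ Λ → [ firstStep? c T μ (lookup Λ fzero) ]
                                      *ᴿ ([ isGoodTExtension? c′ T′ (lookup Λ fzero) Λ ] *ᴿ F Λ))
      ≈⟨ ≈-sym (sumOver-goodTExtensions c T μ (λ Λ → antisym x (lookup Λ (fromℕ (suc ℓ))))) ⟩
    sumOver (goodTExtensions c T μ) (λ Λ → antisym x (lookup Λ (fromℕ (suc ℓ)))) ∎
    where
    c′ T′ : Fin ℓ → ℕ
    c′ h = c (fsuc h)
    T′ h = T (fsuc h)
    B = sum μ + sumFin c T μ T
    L = compsUpTo n B
    hσ W : Vec (Fin n) n → Carrier
    hσ σ = RingDefs.h R (c fzero) (T fzero) (λ i → x (lookup σ (inject≤ i (c≤n fzero))))
    W = hWeight x c′ (λ h → c≤n (fsuc h)) T′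
    F : Vec (Vec ℕ n) (suc ℓ) → Carrier
    F Λ = antisym x (lookup Λ (fromℕ ℓ))
    μ+T≤B : ∀ k → lookup μ k + T fzero ≤ B
    μ+T≤B k = ℕP.+-mono-≤ (lookup≤sum μ k) (ℕP.m≤m+n (T fzero) _)
    W-inv : ∀ j → suc j < c fzero → SwapInvariant W j
    W-inv j j+1<c = prodFin-swapInvariant _ j (λ h →
      hσ-swapAt x (c′ h) (T′ h) (c≤n (fsuc h)) j (ℕP.<-≤-trans j+1<c (c-mono fzero (fsuc h) z≤n)))

-- Lemma 2.1.
lemma2p1 : ∀ {a r : Level} (R : CommutativeRing a r) →
    let open CommutativeRing R
        open RingDefs R
    in (n ℓ : ℕ) → 1 ≤ n →
       (μ : Vec ℕ n) → (∀ (i j : Fin n) → toℕ i < toℕ j → lookup μ j < lookup μ i) →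
       (c : Fin ℓ → ℕ) → (c≤n : ∀ h → c h ≤ n) → (∀ h → 1 ≤ c h) →
       (∀ (h h′ : Fin ℓ) → toℕ h ≤ toℕ h′ → c h ≤ c h′) →
       (T : Fin ℓ → ℕ) →
       (x : Fin n → Carrier) →
       sumL (map (λ σ → sgn σ
                   * (prodFin (λ h → RingDefs.h R (c h) (T h) (λ i → x (lookup σ (inject≤ i (c≤n h)))))
                   * monoσ x σ μ))
                 (Sn n))
         ≈ sumL (map (λ Λ → antisym x (lookup Λ (fromℕ ℓ))) (goodTExtensions c T μ))
lemma2p1 R n ℓ _ μ strict c c≤n _ c-mono T x = Expansion.expansion R n ℓ μ strict c c≤n c-mono T x
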